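{- Let $\alpha\geq 5$ be an integer and let $\mathcal{G}_{\alpha}$ be any hereditary class of graphs (every subgraph of a graph in $\mathcal{G}_{\alpha}$ belongs to $\mathcal{G}_{\alpha}$) such that every graph $G\in\mathcal{G}_{\alpha}$ has minimum degree at most $1$, or contains an edge $uv$ with $d_G(u)+d_G(v)\leq \alpha$, or contains a 2-alternating cycle. Then every graph $G\in\mathcal{G}_{\alpha}$ can be edge-partitioned into two forests $F_1$, $F_2$ and a subgraph $H$ (i.e. $E(G)$ is the disjoint union of $E(F_1)$, $E(F_2)$, $E(H)$) such that $d_{F_i}(v)\leq \max\{2,\lceil\frac{d_G(v)-\alpha+6}{2}\rceil\}$ for every vertex $v$ of $F_i$, $i=1,2$, and $\Delta(H)\leq \alpha-5$.
   Context: Graphs are finite and simple. $d_G(v)$ denotes the degree of $v$ in $G$ (similarly $d_{F_i}(v)$ in $F_i$), and $\Delta(\cdot)$ denotes maximum degree. A 2-alternating cycle in $G$ is a cycle $v_0v_1\cdots v_{2n-1}v_0$ (with $n\geq 2$) such that $d_G(v_0)=d_G(v_2)=\cdots=d_G(v_{2n-2})=2$. -}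

module Defs where

open import Data.Nat using (ℕ; zero; suc; _+_; _*_; _∸_; _≤_; _<_; _⊔_; ⌈_/2⌉)
open import Data.Fin using (Fin; _≟_)
open import Data.Bool using (Bool; true; false; _∧_; if_then_else_)
open import Data.List using (List; map; allFin)
open import Data.Nat.ListAction using (sum)
open import Data.Product using (Σ; _×_; ∃; ∃-syntax; _,_)
open import Data.Sum using (_⊎_)
open import Data.Empty using (⊥)
open import Relation.Nullary using (¬_)
open import Relation.Nullary.Decidable using (⌊_⌋)
open import Relation.Binary.PropositionalEquality using (_≡_; refl; cong₂)
open import Function.Definitions using (Injective)

record Graph : Set where
  field
    n      : ℕ
    adj    : Fin n → Fin n → Bool
    sym    : ∀ u v → adj u v ≡ adj v u
    irrefl : ∀ v → adj v v ≡ false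
open Graph public

deg : (G : Graph) → Fin (n G) → ℕ
deg G v = sum (map (λ u → if adj G v u then 1 else 0) (allFin (n G)))

_⊆G_ : Graph → Graph → Set
H ⊆G G = Σ (Fin (n H) → Fin (n G)) λ f →
           Injective _≡_ _≡_ f ×
           (∀ u v → adj H u v ≡ true → adj G (f u) (f v) ≡ true)

Hereditary : (Graph → Set) → Set
Hereditary P = ∀ G H → H ⊆G G → P G → P H

-- A cycle v_0 v_1 ... v_{len-1} v_0 (len ≥ 3), given as a len-periodic
-- sequence of vertices, distinct within one period, consecutive ones adjacent.
record Cycle (G : Graph) : Set where
  field
    len      : ℕ
    len≥3    : 3 ≤ len
    vs       : ℕ → Fin (n G)
    periodic : ∀ i → vs (i + len) ≡ vs i
    distinct : ∀ i j → i < len → j < len → vs i ≡ vs j → i ≡ j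
    adjacent : ∀ i → adj G (vs i) (vs (suc i)) ≡ true
open Cycle public

Forest : Graph → Set
Forest G = ¬ Cycle G

TwoAlternatingCycle : Graph → Set
TwoAlternatingCycle G =
  Σ (Cycle G) λ C → Σ ℕ λ m → 2 ≤ m × len C ≡ 2 * m ×
    (∀ i → i < m → deg G (vs C (2 * i)) ≡ 2)

colourClass : (G : Graph) (c : Fin (n G) → Fin (n G) → Fin 3) →
              (∀ u v → c u v ≡ c v u) → Fin 3 → Graph
colourClass G c csym i = record
  { n      = n G
  ; adj    = λ u v → adj G u v ∧ ⌊ c u v ≟ i ⌋
  ; sym    = λ u v → cong₂ (λ a b → a ∧ ⌊ b ≟ i ⌋) (sym G u v) (csym u v)
  ; irrefl = λ v → helper (adj G v v) (irrefl G v)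
  }
  where
  helper : ∀ (a : Bool) {b} → a ≡ false → a ∧ b ≡ false
  helper .false refl = refl

-- Induction on n(G) + Σ d(v): the hypothesis always yields a configuration whose removal
-- leaves a smaller graph of the class, and a decomposition of that graph extends to G.
-- An isolated vertex is simply deleted. For a leaf edge or a light edge uv, colour G − uv and
-- give uv a colour with room at both ends, in a forest colour only if uv becomes a pendant edge
-- there. If every colour is blocked, summing the blocked degrees gives d(u) + d(v) ≥ α + 1, and
-- when d(v) = 1 it gives d(u) − 1 ≥ 2κ(d(u)) + α − 5 ≥ d(u) + 1, where κ is the forest bound.
-- For a 2-alternating cycle, remove all edges at its degree-2 vertices: these become leaves of
-- both forests, and each other cycle vertex regains two edges, which fit because
-- κ(d + 2) > κ(d) unless κ(d + 2) = 2, and in that case the degree is so small that H has room.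

module Submission where

open import Defs renaming (sym to adj-sym)
open import Data.Bool using (Bool; true; false; _∧_; _∨_; not; if_then_else_)
open import Data.Bool.Properties using (∨-comm; ¬-not; ∧-conicalˡ; ∧-conicalʳ; ∧-identityʳ; ∧-zeroʳ)
open import Data.Empty using (⊥; ⊥-elim)
open import Data.Fin using (Fin; zero; suc; punchIn; punchOut; _≟_)
open import Data.Fin.Patterns using (0F; 1F; 2F)
open import Data.Fin.Properties
  using (any?; punchInᵢ≢i; punchIn-punchOut; punchIn-injective; punchOut-injective; punchOut-cong; punchOut-punchIn)
open import Data.List using (map; tabulate)
open import Data.Nat using (ℕ; zero; suc; pred; _+_; _*_; _∸_; _⊔_; ⌈_/2⌉; _≤_; _<_; z≤n; s≤s; s≤s⁻¹; z<s; _≤?_; _<?_; >-nonZero)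
open import Data.Nat.DivMod using (_%_; _/_; m≡m%n+[m/n]*n; m%n<n)
open import Data.Nat.ListAction using () renaming (sum to sumˡ)
import Data.Nat as ℕ
open import Data.Nat.Properties hiding (_≟_)
open import Data.Nat.Tactic.RingSolver using (solve-∀)
open import Data.Product using (Σ; ∃; ∃-syntax; _×_; _,_; proj₁; proj₂)
open import Data.Sum using (_⊎_; inj₁; inj₂; [_,_]′)
open import Data.Vec.Functional using (removeAt)
open import Data.Nat.Induction using (<-wellFounded)
open import Induction.WellFounded using (module All)
open import Level using (0ℓ)
import Relation.Binary.Construct.On as On
open import Function using (_∘_; id; _⟨_⟩_; case_of_)
open import Relation.Binary.PropositionalEquality
open import Relation.Nullary using (¬_; Dec; yes; no; contradiction)
open import Relation.Nullary.Decidable using (⌊_⌋; ¬?; _×-dec_; _⊎-dec_; _→-dec_)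

open import Algebra.Properties.CommutativeMonoid.Sum +-0-commutativeMonoid
  using (sum-remove; sum-cong-≗; sum-replicate-zero; ∑-distrib-+) renaming (sum to ∑)

-- Indicators and finite sums

𝟙 : Bool → ℕ
𝟙 b = if b then 1 else 0

⌊⌋-yes : ∀ {P : Set} (d : Dec P) → P → ⌊ d ⌋ ≡ true
⌊⌋-yes (yes _) _ = refl
⌊⌋-yes (no ¬p) p = contradiction p ¬p

⌊⌋-no : ∀ {P : Set} (d : Dec P) → ¬ P → ⌊ d ⌋ ≡ false
⌊⌋-no (yes p) ¬p = contradiction p ¬p
⌊⌋-no (no _)  _  = refl

⌊⌋⇒ : ∀ {P : Set} (d : Dec P) → ⌊ d ⌋ ≡ true → P
⌊⌋⇒ (yes p) _ = p

⌊⌋-cong : ∀ {P Q : Set} (d : Dec P) (d′ : Dec Q) → (P → Q) → (Q → P) → ⌊ d ⌋ ≡ ⌊ d′ ⌋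
⌊⌋-cong (yes _) (yes _) _   _   = refl
⌊⌋-cong (no _)  (no _)  _   _   = refl
⌊⌋-cong (yes p) (no ¬q) p→q _   = contradiction (p→q p) ¬q
⌊⌋-cong (no ¬p) (yes q) _   q→p = contradiction (q→p q) ¬p

if-dec : ∀ {P A : Set} (d : Dec P) {s t : A} →
         P × (if ⌊ d ⌋ then s else t) ≡ s ⊎ ¬ P × (if ⌊ d ⌋ then s else t) ≡ t
if-dec (yes p) = inj₁ (p , refl)
if-dec (no ¬p) = inj₂ (¬p , refl)

∨-true : ∀ {x y} → x ∨ y ≡ true → x ≡ true ⊎ y ≡ true
∨-true {true}  _   = inj₁ refl
∨-true {false} y≡t = inj₂ y≡t

𝟙≤1 : ∀ b → 𝟙 b ≤ 1
𝟙≤1 false = z≤n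
𝟙≤1 true  = ≤-refl

𝟙≟-elim : ∀ {k} {x y : Fin k} (P : ℕ → Set) → (x ≡ y → P 1) → (x ≢ y → P 0) → P (𝟙 ⌊ x ≟ y ⌋)
𝟙≟-elim {x = x} {y} P if-≡ if-≢ with x ≟ y
... | yes x≡y = if-≡ x≡y
... | no x≢y  = if-≢ x≢y

𝟙≟-yes : ∀ {k} {x y : Fin k} → x ≡ y → 𝟙 ⌊ x ≟ y ⌋ ≡ 1
𝟙≟-yes {x = x} {y} x≡y = cong 𝟙 (⌊⌋-yes (x ≟ y) x≡y)

𝟙≟-no : ∀ {k} {x y : Fin k} → x ≢ y → 𝟙 ⌊ x ≟ y ⌋ ≡ 0
𝟙≟-no {x = x} {y} x≢y = cong 𝟙 (⌊⌋-no (x ≟ y) x≢y)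

∑-zero : ∀ {n} {f : Fin n → ℕ} → (∀ i → f i ≡ 0) → ∑ f ≡ 0
∑-zero {n} f≗0 = trans (sum-cong-≗ f≗0) (sum-replicate-zero n)

≤-∑ : ∀ {n} (f : Fin n → ℕ) (p : Fin n) → f p ≤ ∑ f
≤-∑ {suc n} f p = subst (f p ≤_) (sym (sum-remove f)) (m≤m+n (f p) _)

∑-≥₂ : ∀ {n} (f : Fin n → ℕ) {p q : Fin n} → p ≢ q → f p + f q ≤ ∑ f
∑-≥₂ {suc n} f {p} {q} p≢q = begin
  f p + f q                          ≡⟨ cong (λ r → f p + f r) (punchIn-punchOut p≢q) ⟨
  f p + removeAt f p (punchOut p≢q)  ≤⟨ +-monoʳ-≤ (f p) (≤-∑ (removeAt f p) _) ⟩
  f p + ∑ (removeAt f p)             ≡⟨ sum-remove f ⟨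
  ∑ f                                ∎
  where open ≤-Reasoning

∑-≥₃ : ∀ {n} (f : Fin n → ℕ) {p q r : Fin n} → p ≢ q → p ≢ r → q ≢ r → f p + f q + f r ≤ ∑ f
∑-≥₃ {suc n} f {p} {q} {r} p≢q p≢r q≢r = begin
  f p + f q + f r                      ≡⟨ +-assoc (f p) (f q) (f r) ⟩
  f p + (f q + f r)                    ≡⟨ cong₂ (λ s t → f p + (f s + f t)) (punchIn-punchOut p≢q) (punchIn-punchOut p≢r) ⟨
  f p + (f′ (punchOut p≢q) + f′ (punchOut p≢r))
    ≤⟨ +-monoʳ-≤ (f p) (∑-≥₂ f′ (q≢r ∘ punchOut-injective p≢q p≢r)) ⟩
  f p + ∑ f′                           ≡⟨ sum-remove f ⟨
  ∑ f                                  ∎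
  where
  open ≤-Reasoning
  f′ = removeAt f p

∑-skip : ∀ {n} (p : Fin (suc n)) (f : Fin (suc n) → ℕ) → f p ≡ 0 → ∑ f ≡ ∑ (f ∘ punchIn p)
∑-skip p f fp≡0 = trans (sum-remove f) (cong (_+ ∑ (f ∘ punchIn p)) fp≡0)

∑-support₁ : ∀ {n} (f : Fin n → ℕ) (p : Fin n) → (∀ b → b ≢ p → f b ≡ 0) → ∑ f ≡ f p
∑-support₁ {suc n} f p off-p = begin
  ∑ f                     ≡⟨ sum-remove f ⟩
  f p + ∑ (removeAt f p)  ≡⟨ cong (f p +_) (∑-zero (λ i → off-p (punchIn p i) (punchInᵢ≢i p i))) ⟩
  f p + 0                 ≡⟨ +-identityʳ (f p) ⟩
  f p                     ∎
  where open ≡-Reasoning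

∑-support₂ : ∀ {n} (f : Fin n → ℕ) {p q : Fin n} → p ≢ q →
             (∀ b → b ≢ p → b ≢ q → f b ≡ 0) → ∑ f ≡ f p + f q
∑-support₂ {suc n} f {p} {q} p≢q off-pq = begin
  ∑ f                                ≡⟨ sum-remove f ⟩
  f p + ∑ (removeAt f p)             ≡⟨ cong (f p +_) (∑-support₁ (removeAt f p) (punchOut p≢q) off) ⟩
  f p + removeAt f p (punchOut p≢q)  ≡⟨ cong (λ r → f p + f r) (punchIn-punchOut p≢q) ⟩
  f p + f q                          ∎
  where
  open ≡-Reasoning
  off : ∀ i → i ≢ punchOut p≢q → f (punchIn p i) ≡ 0
  off i i≢ = off-pq (punchIn p i) (punchInᵢ≢i p i)
    (λ eq → i≢ (punchIn-injective p i _ (trans eq (sym (punchIn-punchOut p≢q)))))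

∑-support-by : ∀ {n} (f : Fin n → ℕ) (P : Fin n → Bool) {p q : Fin n} → p ≢ q →
               (∀ b → P b ≡ true → b ≡ p ⊎ b ≡ q) → (∀ b → P b ≡ false → f b ≡ 0) → ∑ f ≡ f p + f q
∑-support-by f P p≢q support vanish =
  ∑-support₂ f p≢q (λ b b≢p b≢q → vanish b (¬-not λ Pb → [ b≢p , b≢q ]′ (support b Pb)))

sumˡ-map-tabulate : ∀ {A : Set} {n} (f : A → ℕ) (g : Fin n → A) → sumˡ (map f (tabulate g)) ≡ ∑ (f ∘ g)
sumˡ-map-tabulate {n = zero}  f g = refl
sumˡ-map-tabulate {n = suc n} f g = cong (f (g zero) +_) (sumˡ-map-tabulate f (g ∘ suc))

-- Degrees and cycles

module _ (G : Graph) where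

  private
    V = Fin (n G)

  deg≡∑ : ∀ a → deg G a ≡ ∑ (λ b → 𝟙 (adj G a b))
  deg≡∑ a = sumˡ-map-tabulate (λ b → 𝟙 (adj G a b)) id

  adj⇒≢ : ∀ {a b} → adj G a b ≡ true → a ≢ b
  adj⇒≢ {a} ab refl with () ← trans (sym ab) (irrefl G a)

  adj⇒1≤deg : ∀ {a b} → adj G a b ≡ true → 1 ≤ deg G a
  adj⇒1≤deg {a} {b} ab = begin
    1                                ≡⟨ cong 𝟙 ab ⟨
    𝟙 (adj G a b)                    ≤⟨ ≤-∑ (λ b → 𝟙 (adj G a b)) b ⟩
    ∑ (λ b → 𝟙 (adj G a b))          ≡⟨ deg≡∑ a ⟨
    deg G a                          ∎
    where open ≤-Reasoning

  deg≡0⇒¬adj : ∀ {a} → deg G a ≡ 0 → ∀ b → adj G a b ≡ false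
  deg≡0⇒¬adj {a} d≡0 b = ¬-not (λ ab → contradiction (subst (1 ≤_) d≡0 (adj⇒1≤deg ab)) λ ())

  deg≡1⇒∃adj : ∀ {a} → deg G a ≡ 1 → ∃ λ b → adj G a b ≡ true
  deg≡1⇒∃adj {a} d≡1 with any? (λ b → adj G a b Data.Bool.≟ true)
  ... | yes found = found
  ... | no none = contradiction (trans (sym d≡1) d≡0) λ ()
    where
    d≡0 : deg G a ≡ 0
    d≡0 = trans (deg≡∑ a) (∑-zero (λ b → cong 𝟙 (¬-not (λ ab → none (b , ab)))))

  adj₂⇒2≤deg : ∀ {a b b′} → b ≢ b′ → adj G a b ≡ true → adj G a b′ ≡ true → 2 ≤ deg G a
  adj₂⇒2≤deg {a} {b} {b′} b≢b′ ab ab′ = begin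
    2                                         ≡⟨ cong₂ (λ x y → 𝟙 x + 𝟙 y) ab ab′ ⟨
    𝟙 (adj G a b) + 𝟙 (adj G a b′)            ≤⟨ ∑-≥₂ (λ b → 𝟙 (adj G a b)) b≢b′ ⟩
    ∑ (λ b → 𝟙 (adj G a b))                   ≡⟨ deg≡∑ a ⟨
    deg G a                                   ∎
    where open ≤-Reasoning

module _ {G : Graph} (C : Cycle G) where

  private
    L = len C
    v = vs C
    instance
      L-nonZero = >-nonZero (≤-trans (s≤s z≤n) (len≥3 C))

  vs-periodic : ∀ q r → v (r + q * L) ≡ v r
  vs-periodic zero    r = cong v (+-identityʳ r)
  vs-periodic (suc q) r = begin
    v (r + (L + q * L))  ≡⟨ cong v (trans (cong (r +_) (+-comm L (q * L))) (sym (+-assoc r (q * L) L))) ⟩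
    v (r + q * L + L)    ≡⟨ periodic C (r + q * L) ⟩
    v (r + q * L)        ≡⟨ vs-periodic q r ⟩
    v r                  ∎
    where open ≡-Reasoning

  vs-mod : ∀ i → v i ≡ v (i % L)
  vs-mod i = trans (cong v (m≡m%n+[m/n]*n i L)) (vs-periodic (i / L) (i % L))

  private
    adj-back : ∀ i → adj G (v (suc i)) (v i) ≡ true
    adj-back i = trans (adj-sym G _ _) (adjacent C i)

    L≢2+ : ∀ {i} → suc (suc i) ≡ L → i ≢ 0
    L≢2+ eq refl = <-irrefl eq (len≥3 C)

    last<L : pred L < L
    last<L = subst (pred L <_) (suc-pred L) (n<1+n (pred L))

    deg≥2< : ∀ r → r < L → 2 ≤ deg G (v r)
    deg≥2< zero _ = adj₂⇒2≤deg G 1≢last (adjacent C 0) last-adj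
      where
      1≢last : v 1 ≢ v (pred L)
      1≢last eq = L≢2+ (trans (cong suc (distinct C 1 _ (≤-trans (s≤s (s≤s z≤n)) (len≥3 C)) last<L eq)) (suc-pred L)) refl
      last-adj : adj G (v 0) (v (pred L)) ≡ true
      last-adj = subst (λ w → adj G w (v (pred L)) ≡ true) (trans (cong v (suc-pred L)) (periodic C 0))
                   (adj-back (pred L))
    deg≥2< (suc r) r+1<L with suc (suc r) <? L
    ... | yes r+2<L = adj₂⇒2≤deg G (λ eq → m≢1+n+m r (sym (distinct C _ _ r+2<L r<L eq)))
                        (adjacent C (suc r)) (adj-back r)
      where r<L = <-trans (n<1+n r) r+1<L
    ... | no r+2≮L = adj₂⇒2≤deg G (λ eq → L≢2+ r+2≡L (sym (distinct C 0 r (<-trans z<s r+1<L) r<L eq)))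
                       (subst (λ w → adj G (v (suc r)) w ≡ true) (trans (cong v r+2≡L) (periodic C 0))
                         (adjacent C (suc r)))
                       (adj-back r)
      where
      r<L = <-trans (n<1+n r) r+1<L
      r+2≡L : suc (suc r) ≡ L
      r+2≡L = ≤-antisym r+1<L (≮⇒≥ r+2≮L)

  cycle-deg≥2 : ∀ i → 2 ≤ deg G (v i)
  cycle-deg≥2 i = subst (λ w → 2 ≤ deg G w) (sym (vs-mod i)) (deg≥2< (i % L) (m%n<n i L))

-- Removing edges and vertices

module _ (G : Graph) (r : Fin (n G) → Fin (n G) → Bool) (r-sym : ∀ a b → r a b ≡ r b a) where

  removeEdges : Graph
  removeEdges = record
    { n      = n G
    ; adj    = λ a b → adj G a b ∧ not (r a b)
    ; sym    = λ a b → cong₂ (λ x y → x ∧ not y) (adj-sym G a b) (r-sym a b)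
    ; irrefl = λ a → cong (_∧ not (r a a)) (irrefl G a)
    }

  removeEdges⊆G : removeEdges ⊆G G
  removeEdges⊆G = id , id , λ a b → ∧-conicalˡ _ _

  deg-removeEdges : ∀ a → deg G a ≡ deg removeEdges a + ∑ (λ b → 𝟙 (adj G a b ∧ r a b))
  deg-removeEdges a = begin
    deg G a                                                           ≡⟨ deg≡∑ G a ⟩
    ∑ (λ b → 𝟙 (adj G a b))                                           ≡⟨ sum-cong-≗ (λ b → split (adj G a b) (r a b)) ⟩
    ∑ (λ b → 𝟙 (adj G a b ∧ not (r a b)) + 𝟙 (adj G a b ∧ r a b))     ≡⟨ ∑-distrib-+ (λ b → 𝟙 (adj G a b ∧ not (r a b))) (λ b → 𝟙 (adj G a b ∧ r a b)) ⟩
    ∑ (λ b → 𝟙 (adj G a b ∧ not (r a b))) + ∑ (λ b → 𝟙 (adj G a b ∧ r a b))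
                                                                      ≡⟨ cong (_+ ∑ (λ b → 𝟙 (adj G a b ∧ r a b))) (deg≡∑ removeEdges a) ⟨
    deg removeEdges a + ∑ (λ b → 𝟙 (adj G a b ∧ r a b))               ∎
    where
    open ≡-Reasoning
    split : ∀ x y → 𝟙 x ≡ 𝟙 (x ∧ not y) + 𝟙 (x ∧ y)
    split false _     = refl
    split true  false = refl
    split true  true  = refl

  deg-removeEdges-≤ : ∀ a → deg removeEdges a ≤ deg G a
  deg-removeEdges-≤ a = subst (deg removeEdges a ≤_) (sym (deg-removeEdges a)) (m≤m+n _ _)

size : Graph → ℕ
size G = n G + ∑ (deg G)

size-removeEdges-< : (G : Graph) (r : Fin (n G) → Fin (n G) → Bool) (r-sym : ∀ a b → r a b ≡ r b a) →
                     ∀ {a b} → adj G a b ≡ true → r a b ≡ true → size (removeEdges G r r-sym) < size G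
size-removeEdges-< G r r-sym {a} {b} ab rab = +-monoʳ-< (n G) (begin-strict
  ∑ (deg G′)                       <⟨ m<m+n (∑ (deg G′)) 0<lost ⟩
  ∑ (deg G′) + ∑ lost              ≡⟨ ∑-distrib-+ (deg G′) lost ⟨
  ∑ (λ c → deg G′ c + lost c)      ≡⟨ sum-cong-≗ (λ c → deg-removeEdges G r r-sym c) ⟨
  ∑ (deg G)                        ∎)
  where
  open ≤-Reasoning
  G′ = removeEdges G r r-sym
  lost : Fin (n G) → ℕ
  lost c = ∑ (λ d → 𝟙 (adj G c d ∧ r c d))
  0<lost : 0 < ∑ lost
  0<lost = begin
    1                            ≡⟨ cong₂ (λ x y → 𝟙 (x ∧ y)) ab rab ⟨
    𝟙 (adj G a b ∧ r a b)        ≤⟨ ≤-∑ (λ d → 𝟙 (adj G a d ∧ r a d)) b ⟩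
    lost a                       ≤⟨ ≤-∑ lost a ⟩
    ∑ lost                       ∎

module VertexDeletion {N : ℕ} (A : Fin (suc N) → Fin (suc N) → Bool) (A-sym : ∀ a b → A a b ≡ A b a)
                      (A-irrefl : ∀ a → A a a ≡ false) (v : Fin (suc N)) where

  G : Graph
  G = record { n = suc N ; adj = A ; sym = A-sym ; irrefl = A-irrefl }

  G-v : Graph
  G-v = record
    { n      = N
    ; adj    = λ a b → A (punchIn v a) (punchIn v b)
    ; sym    = λ a b → A-sym (punchIn v a) (punchIn v b)
    ; irrefl = λ a → A-irrefl (punchIn v a)
    }

  G-v⊆G : G-v ⊆G G
  G-v⊆G = punchIn v , (λ {a} {b} → punchIn-injective v a b) , λ _ _ ab → ab

  module _ (isolated : ∀ b → A v b ≡ false) where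

    deg-G-v : ∀ a → deg G (punchIn v a) ≡ deg G-v a
    deg-G-v a = begin
      deg G (punchIn v a)                                    ≡⟨ deg≡∑ G (punchIn v a) ⟩
      ∑ (λ b → 𝟙 (A (punchIn v a) b))                        ≡⟨ ∑-skip v (λ b → 𝟙 (A (punchIn v a) b)) (cong 𝟙 (trans (A-sym _ v) (isolated _))) ⟩
      ∑ (λ b → 𝟙 (A (punchIn v a) (punchIn v b)))            ≡⟨ deg≡∑ G-v a ⟨
      deg G-v a                                              ∎
      where open ≡-Reasoning

    deg-v : deg G v ≡ 0
    deg-v = trans (deg≡∑ G v) (∑-zero (λ b → cong 𝟙 (isolated b)))

    size-G-v-< : size G-v < size G
    size-G-v-< = s≤s (≤-reflexive (cong (N +_) (begin
      ∑ (deg G-v)                 ≡⟨ sum-cong-≗ deg-G-v ⟨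
      ∑ (deg G ∘ punchIn v)       ≡⟨ ∑-skip v (deg G) deg-v ⟨
      ∑ (deg G)                   ∎)))
      where open ≡-Reasoning

-- 2-alternating cycles

module CyclicIndex (m : ℕ) (2≤m : 2 ≤ m) where

  instance
    m-nonZero = >-nonZero (≤-trans (s≤s z≤n) 2≤m)

  prev : ℕ → ℕ
  prev zero    = pred m
  prev (suc i) = i

  next : ℕ → ℕ
  next j = if ⌊ suc j <? m ⌋ then suc j else 0

  prev< : ∀ {i} → i < m → prev i < m
  prev< {zero}  _   = subst (pred m <_) (suc-pred m) (n<1+n (pred m))
  prev< {suc i} i<m = <-trans (n<1+n i) i<m

  prev≢ : ∀ {i} → i < m → prev i ≢ i
  prev≢ {zero}  _ eq = contradiction (≤-trans 2≤m (≤-reflexive (trans (sym (suc-pred m)) (cong suc eq)))) λ { (s≤s ()) }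
  prev≢ {suc i} _ eq = <-irrefl eq (n<1+n i)

  next< : ∀ {j} → j < m → next j < m
  next< {j} j<m with if-dec (suc j <? m) {suc j} {0}
  ... | inj₁ (j+1<m , n≡) = subst (_< m) (sym n≡) j+1<m
  ... | inj₂ (_ , n≡)     = subst (_< m) (sym n≡) (≤-trans (s≤s z≤n) 2≤m)

  prev-next : ∀ {j} → j < m → prev (next j) ≡ j
  prev-next {j} j<m with if-dec (suc j <? m) {suc j} {0}
  ... | inj₁ (_ , n≡)      = cong prev n≡
  ... | inj₂ (j+1≮m , n≡) = trans (cong prev n≡) (cong pred (sym (≤-antisym j<m (≮⇒≥ j+1≮m))))

  next≢ : ∀ {j} → j < m → next j ≢ j
  next≢ j<m eq = prev≢ j<m (trans (cong prev (sym eq)) (prev-next j<m))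

  prev≡⇒≡next : ∀ {i j} → i < m → prev i ≡ j → i ≡ next j
  prev≡⇒≡next {i} {j} i<m eq with if-dec (suc j <? m) {suc j} {0}
  prev≡⇒≡next {zero}  i<m eq | inj₁ (j+1<m , _) =
    contradiction (subst (_< m) (trans (cong suc (sym eq)) (suc-pred m)) j+1<m) (<-irrefl refl)
  prev≡⇒≡next {zero}  i<m eq | inj₂ (_ , n≡)     = sym n≡
  prev≡⇒≡next {suc i} i<m eq | inj₁ (_ , n≡)     = trans (cong suc eq) (sym n≡)
  prev≡⇒≡next {suc i} i<m eq | inj₂ (j+1≮m , _)  = contradiction (subst (λ k → suc k < m) eq i<m) j+1≮m

module AlternatingCycle {G : Graph} (C : Cycle G) (m : ℕ) (2≤m : 2 ≤ m) (len≡ : len C ≡ 2 * m)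
                        (deg-even : ∀ i → i < m → deg G (vs C (2 * i)) ≡ 2) where

  open CyclicIndex m 2≤m public

  private
    V = Fin (n G)

  ev od : ℕ → V
  ev i = vs C (2 * i)
  od i = vs C (suc (2 * i))

  private
    2i<len : ∀ {i} → i < m → 2 * i < len C
    2i<len {i} i<m = subst (2 * i <_) (sym len≡) (*-monoʳ-< 2 i<m)

    2i+1<len : ∀ {i} → i < m → suc (2 * i) < len C
    2i+1<len {i} i<m = subst (suc (2 * i) <_) (sym len≡) (subst (_≤ 2 * m) (*-suc 2 i) (*-monoʳ-≤ 2 i<m))

  ev-injective : ∀ {i j} → i < m → j < m → ev i ≡ ev j → i ≡ j
  ev-injective {i} {j} i<m j<m eq = *-cancelˡ-≡ i j 2 (distinct C _ _ (2i<len i<m) (2i<len j<m) eq)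

  od-injective : ∀ {i j} → i < m → j < m → od i ≡ od j → i ≡ j
  od-injective {i} {j} i<m j<m eq = *-cancelˡ-≡ i j 2 (suc-injective (distinct C _ _ (2i+1<len i<m) (2i+1<len j<m) eq))

  ev≢od : ∀ {i j} → i < m → j < m → ev i ≢ od j
  ev≢od {i} {j} i<m j<m eq = even≢odd i j (distinct C _ _ (2i<len i<m) (2i+1<len j<m) eq)

  od≢od-prev : ∀ {i} → i < m → od i ≢ od (prev i)
  od≢od-prev i<m eq = prev≢ i<m (sym (od-injective i<m (prev< i<m) eq))

  ev-od-adj : ∀ i → adj G (ev i) (od i) ≡ true
  ev-od-adj i = adjacent C (2 * i)

  od-prev-ev-adj : ∀ {i} → i < m → adj G (od (prev i)) (ev i) ≡ true
  od-prev-ev-adj {i} i<m = subst (λ w → adj G (od (prev i)) w ≡ true) (wrap i) (adjacent C (suc (2 * prev i)))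
    where
    wrap : ∀ i → vs C (2 + 2 * prev i) ≡ ev i
    wrap zero    = trans (cong (vs C) (trans (sym (*-suc 2 (pred m))) (trans (cong (2 *_) (suc-pred m)) (sym len≡))))
                         (periodic C 0)
    wrap (suc i) = cong (vs C) (sym (*-suc 2 i))

  even-neighbours : ∀ {i} → i < m → ∀ b → adj G (ev i) b ≡ true → b ≡ od i ⊎ b ≡ od (prev i)
  even-neighbours {i} i<m b ab with b ≟ od i | b ≟ od (prev i)
  ... | yes b≡ | _      = inj₁ b≡
  ... | no _   | yes b≡ = inj₂ b≡
  ... | no b≢  | no b≢′ = contradiction (begin
    3                                                  ≡⟨ cong₂ _+_ (cong₂ (λ x y → 𝟙 x + 𝟙 y) (ev-od-adj i)
                                                            (trans (adj-sym G _ _) (od-prev-ev-adj i<m))) (cong 𝟙 ab) ⟨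
    𝟙 (adj G (ev i) (od i)) + 𝟙 (adj G (ev i) (od (prev i))) + 𝟙 (adj G (ev i) b)
                                                       ≤⟨ ∑-≥₃ (λ b → 𝟙 (adj G (ev i) b)) (od≢od-prev i<m) (b≢ ∘ sym) (b≢′ ∘ sym) ⟩
    ∑ (λ b → 𝟙 (adj G (ev i) b))                       ≡⟨ deg≡∑ G (ev i) ⟨
    deg G (ev i)                                       ≡⟨ deg-even i i<m ⟩
    2                                                  ∎) λ { (s≤s (s≤s ())) }
    where open ≤-Reasoning

  odd-neighbour-even : ∀ {i j} → i < m → j < m → adj G (od j) (ev i) ≡ true → i ≡ j ⊎ i ≡ next j
  odd-neighbour-even {i} {j} i<m j<m ab with even-neighbours i<m (od j) (trans (adj-sym G _ _) ab)
  ... | inj₁ eq = inj₁ (od-injective i<m j<m (sym eq))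
  ... | inj₂ eq = inj₂ (prev≡⇒≡next i<m (od-injective (prev< i<m) j<m (sym eq)))

  IsEven : V → Set
  IsEven a = ∃ λ i → i < m × ev i ≡ a

  isEven? : ∀ a → Dec (IsEven a)
  isEven? a = anyUpTo? (λ i → ev i ≟ a) m

  isEven : V → Bool
  isEven a = ⌊ isEven? a ⌋

  ev-isEven : ∀ {i} → i < m → isEven (ev i) ≡ true
  ev-isEven {i} i<m = ⌊⌋-yes (isEven? _) (i , i<m , refl)

  od-¬IsEven : ∀ {j} → j < m → ¬ IsEven (od j)
  od-¬IsEven j<m (i , i<m , eq) = ev≢od i<m j<m eq

  od-isEven : ∀ {j} → j < m → isEven (od j) ≡ false
  od-isEven j<m = ⌊⌋-no (isEven? _) (od-¬IsEven j<m)

  vertex-kind : ∀ a → IsEven a ⊎ (∃ λ j → j < m × od j ≡ a) ⊎ (¬ IsEven a × ∀ j → j < m → od j ≢ a)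
  vertex-kind a with isEven? a | anyUpTo? (λ j → od j ≟ a) m
  ... | yes even   | _       = inj₁ even
  ... | no _       | yes odd = inj₂ (inj₁ odd)
  ... | no ¬even   | no ¬odd = inj₂ (inj₂ (¬even , λ j j<m eq → ¬odd (j , j<m , eq)))

  touchesEven : V → V → Bool
  touchesEven a b = isEven a ∨ isEven b

  touchesEven-sym : ∀ a b → touchesEven a b ≡ touchesEven b a
  touchesEven-sym a b = ∨-comm (isEven a) (isEven b)

  G′ : Graph
  G′ = removeEdges G touchesEven touchesEven-sym

  size-G′-< : size G′ < size G
  size-G′-< = size-removeEdges-< G touchesEven touchesEven-sym (ev-od-adj 0)
                (cong (_∨ isEven (od 0)) (ev-isEven (≤-trans (s≤s z≤n) 2≤m)))

  lost-at-odd : ∀ {j} → j < m → ∀ b → adj G (od j) b ∧ touchesEven (od j) b ≡ true → b ≡ ev j ⊎ b ≡ ev (next j)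
  lost-at-odd {j} j<m b lost with ⌊⌋⇒ (isEven? b) (subst (λ x → x ∨ isEven b ≡ true) (od-isEven j<m) (∧-conicalʳ _ _ lost))
  ... | i , i<m , refl with odd-neighbour-even i<m j<m (∧-conicalˡ _ _ lost)
  ...   | inj₁ refl = inj₁ refl
  ...   | inj₂ refl = inj₂ refl

  lost-elsewhere : ∀ {a} → ¬ IsEven a → (∀ j → j < m → od j ≢ a) → ∀ b → adj G a b ∧ touchesEven a b ≡ false
  lost-elsewhere {a} ¬even ¬odd b = ¬-not λ lost → case ⌊⌋⇒ (isEven? b)
      (subst (λ x → x ∨ isEven b ≡ true) (⌊⌋-no (isEven? a) ¬even) (∧-conicalʳ _ _ lost)) of λ where
    (i , i<m , refl) → case even-neighbours i<m a (trans (adj-sym G _ _) (∧-conicalˡ _ _ lost)) of λ where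
      (inj₁ a≡) → ¬odd i i<m (sym a≡)
      (inj₂ a≡) → ¬odd (prev i) (prev< i<m) (sym a≡)

-- Edge colourings

record Colouring (G : Graph) : Set where
  field
    colour     : Fin (n G) → Fin (n G) → Fin 3
    colour-sym : ∀ a b → colour a b ≡ colour b a

  class : Fin 3 → Graph
  class = colourClass G colour colour-sym

  degᶜ : Fin 3 → Fin (n G) → ℕ
  degᶜ X = deg (class X)

  deg-partition : ∀ a → deg G a ≡ degᶜ 0F a + degᶜ 1F a + degᶜ 2F a
  deg-partition a = begin
    deg G a                                                 ≡⟨ deg≡∑ G a ⟩
    ∑ (λ b → 𝟙 (adj G a b))                                 ≡⟨ sum-cong-≗ (λ b → split (adj G a b) (colour a b)) ⟩
    ∑ (λ b → in-class 0F b + in-class 1F b + in-class 2F b)  ≡⟨ ∑-distrib-+ (λ b → in-class 0F b + in-class 1F b) (in-class 2F) ⟩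
    ∑ (λ b → in-class 0F b + in-class 1F b) + ∑ (in-class 2F)
                                                            ≡⟨ cong (_+ ∑ (in-class 2F)) (∑-distrib-+ (in-class 0F) (in-class 1F)) ⟩
    ∑ (in-class 0F) + ∑ (in-class 1F) + ∑ (in-class 2F)     ≡⟨ cong₂ _+_ (cong₂ _+_ (deg≡∑ (class 0F) a) (deg≡∑ (class 1F) a))
                                                                         (deg≡∑ (class 2F) a) ⟨
    degᶜ 0F a + degᶜ 1F a + degᶜ 2F a                       ∎
    where
    open ≡-Reasoning
    in-class : Fin 3 → Fin (n G) → ℕ
    in-class X b = 𝟙 (adj G a b ∧ ⌊ colour a b ≟ X ⌋)
    split : ∀ x (c : Fin 3) → 𝟙 x ≡ 𝟙 (x ∧ ⌊ c ≟ 0F ⌋) + 𝟙 (x ∧ ⌊ c ≟ 1F ⌋) + 𝟙 (x ∧ ⌊ c ≟ 2F ⌋)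
    split false _  = refl
    split true  0F = refl
    split true  1F = refl
    split true  2F = refl

  degᶜ≤deg : ∀ X a → degᶜ X a ≤ deg G a
  degᶜ≤deg 0F a = subst (degᶜ 0F a ≤_) (sym (deg-partition a))
    (≤-trans (m≤m+n (degᶜ 0F a) (degᶜ 1F a)) (m≤m+n _ (degᶜ 2F a)))
  degᶜ≤deg 1F a = subst (degᶜ 1F a ≤_) (sym (deg-partition a))
    (≤-trans (m≤n+m (degᶜ 1F a) (degᶜ 0F a)) (m≤m+n _ (degᶜ 2F a)))
  degᶜ≤deg 2F a = subst (degᶜ 2F a ≤_) (sym (deg-partition a)) (m≤n+m (degᶜ 2F a) _)

open Colouring public

module Recolouring {G : Graph} (r : Fin (n G) → Fin (n G) → Bool) (r-sym : ∀ a b → r a b ≡ r b a)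
                   (κ′ : Colouring (removeEdges G r r-sym))
                   (σ : Fin (n G) → Fin (n G) → Fin 3) (σ-sym : ∀ a b → σ a b ≡ σ b a) where

  recoloured : Colouring G
  recoloured = record
    { colour     = λ a b → if r a b then σ a b else colour κ′ a b
    ; colour-sym = λ a b → cong₂ (λ x y → if x then σ a b else y) (r-sym a b) (colour-sym κ′ a b)
                             ⟨ trans ⟩ cong (λ s → if r b a then s else colour κ′ b a) (σ-sym a b)
    }

  deg-recoloured : ∀ X a → degᶜ recoloured X a
                   ≡ degᶜ κ′ X a + ∑ (λ b → 𝟙 ((adj G a b ∧ r a b) ∧ ⌊ σ a b ≟ X ⌋))
  deg-recoloured X a = begin
    degᶜ recoloured X a ≡⟨ deg≡∑ (class recoloured X) a ⟩
    ∑ (λ b → 𝟙 (adj G a b ∧ ⌊ colour recoloured a b ≟ X ⌋))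
      ≡⟨ sum-cong-≗ (λ b → split (adj G a b) (r a b) (σ a b) (colour κ′ a b)) ⟩
    ∑ (λ b → kept b + added b)  ≡⟨ ∑-distrib-+ kept added ⟩
    ∑ kept + ∑ added            ≡⟨ cong (_+ ∑ added) (deg≡∑ (class κ′ X) a) ⟨
    degᶜ κ′ X a + ∑ added        ∎
    where
    open ≡-Reasoning
    kept added : Fin (n G) → ℕ
    kept  b = 𝟙 ((adj G a b ∧ not (r a b)) ∧ ⌊ colour κ′ a b ≟ X ⌋)
    added b = 𝟙 ((adj G a b ∧ r a b) ∧ ⌊ σ a b ≟ X ⌋)
    split : ∀ x y (s t : Fin 3) →
            𝟙 (x ∧ ⌊ (if y then s else t) ≟ X ⌋) ≡ 𝟙 ((x ∧ not y) ∧ ⌊ t ≟ X ⌋) + 𝟙 ((x ∧ y) ∧ ⌊ s ≟ X ⌋)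
    split false _     s t = refl
    split true  true  s t = refl
    split true  false s t = sym (+-identityʳ _)

  recoloured-kept : ∀ X a b → adj (class recoloured X) a b ≡ true → r a b ≡ false → adj (class κ′ X) a b ≡ true
  recoloured-kept X a b ab rab rewrite rab | ∧-identityʳ (adj G a b) = ab

  recoloured-forest : ∀ X → Forest (class κ′ X) →
    (∀ a b → adj (class recoloured X) a b ≡ true → r a b ≡ true →
       degᶜ recoloured X a ≤ 1 ⊎ degᶜ recoloured X b ≤ 1) →
    Forest (class recoloured X)
  recoloured-forest X forest pendant C = forest record
    { len = len C ; len≥3 = len≥3 C ; vs = vs C ; periodic = periodic C ; distinct = distinct C
    ; adjacent = kept }
    where
    kept : ∀ i → adj (class κ′ X) (vs C i) (vs C (suc i)) ≡ true
    kept i = by-removal _ refl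
      where
      by-removal : ∀ x → r (vs C i) (vs C (suc i)) ≡ x → adj (class κ′ X) (vs C i) (vs C (suc i)) ≡ true
      by-removal false removed = recoloured-kept X _ _ (adjacent C i) removed
      by-removal true  removed with pendant _ _ (adjacent C i) removed
      ... | inj₁ d≤1 = contradiction (≤-trans (cycle-deg≥2 C i) d≤1) (<-irrefl refl)
      ... | inj₂ d≤1 = contradiction (≤-trans (cycle-deg≥2 C (suc i)) d≤1) (<-irrefl refl)

-- Decompositions

module _ (α : ℕ) (5≤α : 5 ≤ α) where

  κ : ℕ → ℕ
  κ d = 2 ⊔ ⌈ (d + 6) ∸ α /2⌉

  η : ℕ
  η = α ∸ 5

  -- Colours 0F and 1F are the forests F₁ and F₂, colour 2F is H.
  capacity : Fin 3 → ℕ → ℕ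
  capacity 0F = κ
  capacity 1F = κ
  capacity 2F = λ _ → η

  2≤κ : ∀ d → 2 ≤ κ d
  2≤κ d = m≤m⊔n 2 ⌈ (d + 6) ∸ α /2⌉

  κ-mono : ∀ {d e} → d ≤ e → κ d ≤ κ e
  κ-mono d≤e = ⊔-monoʳ-≤ 2 (⌈n/2⌉-mono (∸-monoˡ-≤ α (+-monoˡ-≤ 6 d≤e)))

  2≤capacity : ∀ X → X ≢ 2F → ∀ d → 2 ≤ capacity X d
  2≤capacity 0F _ = 2≤κ
  2≤capacity 1F _ = 2≤κ
  2≤capacity 2F 2F≢2F = contradiction refl 2F≢2F

  capacity-mono : ∀ X {d e} → d ≤ e → capacity X d ≤ capacity X e
  capacity-mono 0F = κ-mono
  capacity-mono 1F = κ-mono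
  capacity-mono 2F = λ _ → ≤-refl

  1+d≤2κ+η : ∀ d → suc d ≤ κ d + κ d + η
  1+d≤2κ+η d = +-cancelʳ-≤ 5 (suc d) (κ d + κ d + η) (begin
    suc d + 5             ≡⟨ +-suc d 5 ⟨
    d + 6                 ≤⟨ m≤n+m∸n (d + 6) α ⟩
    α + t                 ≤⟨ +-monoʳ-≤ α t≤2⌈t/2⌉ ⟩
    α + (c + c)           ≤⟨ +-monoʳ-≤ α (+-mono-≤ c≤κ c≤κ) ⟩
    α + (κ d + κ d)       ≡⟨ +-comm α (κ d + κ d) ⟩
    κ d + κ d + α         ≡⟨ cong (κ d + κ d +_) (m∸n+n≡m 5≤α) ⟨
    κ d + κ d + (η + 5)   ≡⟨ +-assoc (κ d + κ d) η 5 ⟨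
    κ d + κ d + η + 5     ∎)
    where
    open ≤-Reasoning
    t = (d + 6) ∸ α
    c = ⌈ t /2⌉
    c≤κ : c ≤ κ d
    c≤κ = m≤n⊔m 2 c
    t≤2⌈t/2⌉ : t ≤ c + c
    t≤2⌈t/2⌉ = subst (_≤ c + c) (⌊n/2⌋+⌈n/2⌉≡n t) (+-monoˡ-≤ c (⌊n/2⌋≤⌈n/2⌉ t))

  κ-step : ∀ d → κ (2 + d) ≡ 2 ⊎ κ d < κ (2 + d)
  κ-step d with α ≤? d + 6
  ... | no α≰d+6 = inj₁ (m≥n⇒m⊔n≡m (≤-trans (⌈n/2⌉-mono {_} {1} (begin
    (2 + d + 6) ∸ α            ≤⟨ ∸-monoʳ-≤ (2 + d + 6) (≰⇒> α≰d+6) ⟩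
    (2 + d + 6) ∸ suc (d + 6)  ≡⟨ m+n∸n≡m 1 (suc (d + 6)) ⟩
    1                          ∎)) (n≤1+n 1)))
    where open ≤-Reasoning
  ... | yes α≤d+6 with ⌈ (d + 6) ∸ α /2⌉ ≤? 1
  ...   | yes c≤1 = inj₁ (trans (cong (λ s → 2 ⊔ ⌈ s /2⌉) shift) (m≥n⇒m⊔n≡m (s≤s c≤1)))
    where shift = +-∸-assoc 2 α≤d+6
  ...   | no c≰1 = inj₂ (begin-strict
    κ d                        ≡⟨ m≤n⇒m⊔n≡n (≰⇒> c≰1) ⟩
    ⌈ (d + 6) ∸ α /2⌉          <⟨ n<1+n _ ⟩
    ⌈ 2 + ((d + 6) ∸ α) /2⌉    ≡⟨ cong ⌈_/2⌉ (+-∸-assoc 2 α≤d+6) ⟨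
    ⌈ (2 + d + 6) ∸ α /2⌉      ≤⟨ m≤n⊔m 2 _ ⟩
    κ (2 + d)                  ∎)
    where open ≤-Reasoning

  record Decomposition (G : Graph) : Set where
    field
      colouring : Colouring G
      forest    : ∀ X → X ≢ 2F → Forest (class colouring X)
      bounded   : ∀ X a → degᶜ colouring X a ≤ capacity X (deg G a)

  open Decomposition public

  record Reduction (G : Graph) : Set where
    field
      smaller   : Graph
      smaller⊆G : smaller ⊆G G
      size-<    : size smaller < size G
      lift      : Decomposition smaller → Decomposition G

  bounded-removeEdges : ∀ {G r r-sym} (D : Decomposition (removeEdges G r r-sym)) →
                        ∀ X a → degᶜ (colouring D) X a ≤ capacity X (deg G a)
  bounded-removeEdges {G} {r} {r-sym} D X a =
    ≤-trans (bounded D X a) (capacity-mono X (deg-removeEdges-≤ G r r-sym a))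

  +-interchange₃ : ∀ a b c d e f → (a + b + c) + (d + e + f) ≡ (a + d) + (b + e) + (c + f)
  +-interchange₃ = solve-∀

  blocked-forest-colour : ∀ {a b k l} → 2 ≤ k → 2 ≤ l → (a < k → b < l → a ≡ 0 ⊎ b ≡ 0 → ⊥) → 2 ≤ a + b
  blocked-forest-colour {zero} {b} {l = l} 2≤k 2≤l blocked with b <? l
  ... | yes b<l = ⊥-elim (blocked (≤-trans (s≤s z≤n) 2≤k) b<l (inj₁ refl))
  ... | no b≮l = ≤-trans 2≤l (≮⇒≥ b≮l)
  blocked-forest-colour {suc zero} {zero} 2≤k 2≤l blocked = ⊥-elim (blocked 2≤k (≤-trans (s≤s z≤n) 2≤l) (inj₂ refl))
  blocked-forest-colour {suc zero} {suc b} _ _ _ = s≤s (s≤s z≤n)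
  blocked-forest-colour {suc (suc a)} _ _ _ = s≤s (s≤s z≤n)

  blocked-residual-colour : ∀ {a b} → (a < η → b < η → ⊥) → η ≤ a + b
  blocked-residual-colour {a} {b} blocked with a <? η | b <? η
  ... | yes a<η | yes b<η = ⊥-elim (blocked a<η b<η)
  ... | no a≮η  | _       = ≤-trans (≮⇒≥ a≮η) (m≤m+n a b)
  ... | yes _   | no b≮η  = ≤-trans (≮⇒≥ b≮η) (m≤n+m b a)

  module EdgeRemoval {G : Graph} {u v : Fin (n G)} (uv : adj G u v ≡ true) where

    private
      V = Fin (n G)

    IsUV : V → V → Set
    IsUV a b = a ≡ u × b ≡ v ⊎ a ≡ v × b ≡ u

    isUV? : ∀ a b → Dec (IsUV a b)
    isUV? a b = (a ≟ u ×-dec b ≟ v) ⊎-dec (a ≟ v ×-dec b ≟ u)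

    isUV : V → V → Bool
    isUV a b = ⌊ isUV? a b ⌋

    IsUV-swap : ∀ {a b} → IsUV a b → IsUV b a
    IsUV-swap (inj₁ (a≡u , b≡v)) = inj₂ (b≡v , a≡u)
    IsUV-swap (inj₂ (a≡v , b≡u)) = inj₁ (b≡u , a≡v)

    isUV-sym : ∀ a b → isUV a b ≡ isUV b a
    isUV-sym a b = ⌊⌋-cong (isUV? a b) (isUV? b a) IsUV-swap IsUV-swap

    isUV⇒IsUV : ∀ {a b} → isUV a b ≡ true → IsUV a b
    isUV⇒IsUV {a} {b} = ⌊⌋⇒ (isUV? a b)

    G∖uv : Graph
    G∖uv = removeEdges G isUV isUV-sym

    record Endpoint (w w′ : V) : Set where
      field
        edge : adj G w w′ ≡ true
        lost : isUV w w′ ≡ true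
        only : ∀ b → isUV w b ≡ true → b ≡ w′

    endpoint-u : Endpoint u v
    endpoint-u = record
      { edge = uv
      ; lost = ⌊⌋-yes (isUV? u v) (inj₁ (refl , refl))
      ; only = λ b eq → only (isUV⇒IsUV eq) }
      where
      only : ∀ {b} → IsUV u b → b ≡ v
      only (inj₁ (_ , b≡v))   = b≡v
      only (inj₂ (u≡v , _))   = contradiction u≡v (adj⇒≢ G uv)

    endpoint-v : Endpoint v u
    endpoint-v = record
      { edge = trans (adj-sym G v u) uv
      ; lost = ⌊⌋-yes (isUV? v u) (inj₂ (refl , refl))
      ; only = λ b eq → only (isUV⇒IsUV eq) }
      where
      only : ∀ {b} → IsUV v b → b ≡ u
      only (inj₁ (v≡u , _))   = contradiction (sym v≡u) (adj⇒≢ G uv)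
      only (inj₂ (_ , b≡u))   = b≡u

    isUV-elsewhere : ∀ {a} → a ≢ u → a ≢ v → ∀ b → isUV a b ≡ false
    isUV-elsewhere a≢u a≢v b = ⌊⌋-no (isUV? _ b) λ where
      (inj₁ (a≡u , _)) → a≢u a≡u
      (inj₂ (a≡v , _)) → a≢v a≡v

    ∑-at-endpoint : ∀ {w w′} → Endpoint w w′ → (f : V → ℕ) → (∀ b → isUV w b ≡ false → f b ≡ 0) → ∑ f ≡ f w′
    ∑-at-endpoint e f vanish = ∑-support₁ f _ (λ b b≢w′ → vanish b (¬-not (b≢w′ ∘ Endpoint.only e b)))

    deg-endpoint : ∀ {w w′} → Endpoint w w′ → deg G w ≡ deg G∖uv w + 1
    deg-endpoint {w} {w′} e = begin
      deg G w                                                ≡⟨ deg-removeEdges G isUV isUV-sym w ⟩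
      deg G∖uv w + ∑ (λ b → 𝟙 (adj G w b ∧ isUV w b))        ≡⟨ cong (deg G∖uv w +_) (∑-at-endpoint e _ vanish) ⟩
      deg G∖uv w + 𝟙 (adj G w w′ ∧ isUV w w′)                ≡⟨ cong₂ (λ x y → deg G∖uv w + 𝟙 (x ∧ y)) (Endpoint.edge e) (Endpoint.lost e) ⟩
      deg G∖uv w + 1                                         ∎
      where
      open ≡-Reasoning
      vanish : ∀ b → isUV w b ≡ false → 𝟙 (adj G w b ∧ isUV w b) ≡ 0
      vanish b lost rewrite lost | ∧-zeroʳ (adj G w b) = refl

    module _ (D : Decomposition G∖uv) where

      private
        κ′ = colouring D
        a : Fin 3 → V → ℕ
        a = degᶜ κ′

      -- The last condition makes uv a pendant edge of its forest.
      Admissible : Fin 3 → Set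
      Admissible X = a X u < capacity X (deg G u) × a X v < capacity X (deg G v)
                     × (X ≢ 2F → a X u ≡ 0 ⊎ a X v ≡ 0)

      admissible? : ∀ X → Dec (Admissible X)
      admissible? X = (a X u <? _) ×-dec (a X v <? _) ×-dec (¬? (X ≟ 2F) →-dec (a X u ℕ.≟ 0 ⊎-dec a X v ℕ.≟ 0))

      extend : ∀ X → Admissible X → Decomposition G
      extend X (room-u , room-v , pendant) = record
        { colouring = recoloured
        ; forest    = λ Y Y≢2F → recoloured-forest Y (forest D Y Y≢2F) (pendant-edge Y Y≢2F)
        ; bounded   = λ Y b → bounded-at Y b (b ≟ u) (b ≟ v)
        }
        where
        open Recolouring isUV isUV-sym κ′ (λ _ _ → X) (λ _ _ → refl)

        deg-at-endpoint : ∀ {w w′} → Endpoint w w′ → ∀ Y → degᶜ recoloured Y w ≡ a Y w + 𝟙 ⌊ X ≟ Y ⌋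
        deg-at-endpoint {w} {w′} e Y = trans (deg-recoloured Y w) (cong (a Y w +_) (trans (∑-at-endpoint e _ vanish)
          (cong₂ (λ x y → 𝟙 ((x ∧ y) ∧ ⌊ X ≟ Y ⌋)) (Endpoint.edge e) (Endpoint.lost e))))
          where
          vanish : ∀ b → isUV w b ≡ false → 𝟙 ((adj G w b ∧ isUV w b) ∧ ⌊ X ≟ Y ⌋) ≡ 0
          vanish b lost rewrite lost | ∧-zeroʳ (adj G w b) = refl

        deg-elsewhere : ∀ {b} → b ≢ u → b ≢ v → ∀ Y → degᶜ recoloured Y b ≡ a Y b
        deg-elsewhere {b} b≢u b≢v Y = trans (deg-recoloured Y b) (trans (cong (a Y b +_) (∑-zero vanish)) (+-identityʳ _))
          where
          vanish : ∀ c → 𝟙 ((adj G b c ∧ isUV b c) ∧ ⌊ X ≟ Y ⌋) ≡ 0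
          vanish c rewrite isUV-elsewhere b≢u b≢v c | ∧-zeroʳ (adj G b c) = refl

        bounded-at-endpoint : ∀ {w w′} → Endpoint w w′ → a X w < capacity X (deg G w) →
                              ∀ Y → degᶜ recoloured Y w ≤ capacity Y (deg G w)
        bounded-at-endpoint {w} e room Y rewrite deg-at-endpoint e Y with X ≟ Y
        ... | yes refl = subst (_≤ capacity X (deg G w)) (+-comm 1 (a X w)) room
        ... | no _     = subst (_≤ capacity Y (deg G w)) (sym (+-identityʳ _)) (bounded-removeEdges D Y w)

        bounded-at : ∀ Y b → Dec (b ≡ u) → Dec (b ≡ v) → degᶜ recoloured Y b ≤ capacity Y (deg G b)
        bounded-at Y b (yes refl) _          = bounded-at-endpoint endpoint-u room-u Y
        bounded-at Y b (no _)     (yes refl) = bounded-at-endpoint endpoint-v room-v Y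
        bounded-at Y b (no b≢u)   (no b≢v)   =
          subst (_≤ capacity Y (deg G b)) (sym (deg-elsewhere b≢u b≢v Y)) (bounded-removeEdges D Y b)

        pendant-at : ∀ {w w′} → Endpoint w w′ → a X w ≡ 0 → degᶜ recoloured X w ≤ 1
        pendant-at e bare rewrite deg-at-endpoint e X | bare | 𝟙≟-yes (refl {x = X}) = ≤-refl

        pendant-edge : ∀ Y → Y ≢ 2F → ∀ b c → adj (class recoloured Y) b c ≡ true → isUV b c ≡ true →
                       degᶜ recoloured Y b ≤ 1 ⊎ degᶜ recoloured Y c ≤ 1
        colour-of-lost : ∀ {Y b c} → adj (class recoloured Y) b c ≡ true → isUV b c ≡ true → X ≡ Y
        colour-of-lost {Y} {b} {c} edge lost = ⌊⌋⇒ (X ≟ Y)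
          (subst (λ z → ⌊ (if z then X else colour κ′ b c) ≟ Y ⌋ ≡ true) lost (∧-conicalʳ _ _ edge))

        pendant-edge Y Y≢2F b c edge lost with colour-of-lost edge lost | isUV⇒IsUV lost
        ... | refl | inj₁ (refl , refl) = [ inj₁ ∘ pendant-at endpoint-u , inj₂ ∘ pendant-at endpoint-v ]′ (pendant Y≢2F)
        ... | refl | inj₂ (refl , refl) = [ inj₂ ∘ pendant-at endpoint-u , inj₁ ∘ pendant-at endpoint-v ]′ (pendant Y≢2F)

      extend-unless-blocked : ¬ (∀ X → ¬ Admissible X) → Decomposition G
      extend-unless-blocked not-blocked with any? admissible?
      ... | yes (X , adm) = extend X adm
      ... | no none       = contradiction (λ X adm → none (X , adm)) not-blocked

      heavy-if-blocked : (∀ X → ¬ Admissible X) → η + 6 ≤ deg G u + deg G v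
      heavy-if-blocked blocked = begin
        η + 6                                                          ≡⟨ trans (+-comm η 6) (cong (4 +_) (+-comm 2 η)) ⟩
        2 + 2 + η + 2                                                  ≤⟨ +-monoˡ-≤ 2 (+-mono-≤ (+-mono-≤ (pair 0F (λ ())) (pair 1F (λ ()))) residual) ⟩
        (a 0F u + a 0F v) + (a 1F u + a 1F v) + (a 2F u + a 2F v) + 2  ≡⟨ cong (_+ 2) (+-interchange₃ (a 0F u) (a 1F u) (a 2F u) (a 0F v) (a 1F v) (a 2F v)) ⟨
        (a 0F u + a 1F u + a 2F u) + (a 0F v + a 1F v + a 2F v) + 2    ≡⟨ cong₂ (λ x y → x + y + 2) (deg-partition κ′ u) (deg-partition κ′ v) ⟨
        deg G∖uv u + deg G∖uv v + 2                                    ≡⟨ +-interchange₂ (deg G∖uv u) (deg G∖uv v) ⟩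
        (deg G∖uv u + 1) + (deg G∖uv v + 1)                            ≡⟨ cong₂ _+_ (deg-endpoint endpoint-u) (deg-endpoint endpoint-v) ⟨
        deg G u + deg G v                                              ∎
        where
        open ≤-Reasoning
        +-interchange₂ : ∀ x y → x + y + 2 ≡ (x + 1) + (y + 1)
        +-interchange₂ = solve-∀
        pair : ∀ X → X ≢ 2F → 2 ≤ a X u + a X v
        pair X X≢2F = blocked-forest-colour (2≤capacity X X≢2F _) (2≤capacity X X≢2F _)
                        (λ ru rv bare → blocked X (ru , rv , λ _ → bare))
        residual : η ≤ a 2F u + a 2F v
        residual = blocked-residual-colour (λ ru rv → blocked 2F (ru , rv , λ 2F≢2F → contradiction refl 2F≢2F))

      leaf-if-blocked : (∀ X → ¬ Admissible X) → deg G v ≢ 1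
      leaf-if-blocked blocked leaf = <-irrefl refl (begin-strict
        deg G∖uv u                ≤⟨ m≤m+n (deg G∖uv u) 1 ⟩
        deg G∖uv u + 1            ≡⟨ deg-endpoint endpoint-u ⟨
        deg G u                   <⟨ 1+d≤2κ+η (deg G u) ⟩
        κ (deg G u) + κ (deg G u) + η
                                  ≤⟨ +-mono-≤ (+-mono-≤ (full 0F) (full 1F)) (full 2F) ⟩
        a 0F u + a 1F u + a 2F u  ≡⟨ deg-partition κ′ u ⟨
        deg G∖uv u                ∎)
        where
        open ≤-Reasoning
        v-bare : ∀ X → a X v ≡ 0
        v-bare X = n≤0⇒n≡0 (≤-trans (degᶜ≤deg κ′ X v)
          (≤-reflexive (+-cancelʳ-≡ 1 _ 0 (trans (sym (deg-endpoint endpoint-v)) leaf))))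
        positive : ∀ X → a X u < capacity X (deg G u) → 0 < capacity X (deg G v)
        positive 0F _    = ≤-trans (s≤s z≤n) (2≤κ _)
        positive 1F _    = ≤-trans (s≤s z≤n) (2≤κ _)
        positive 2F room = ≤-trans (s≤s z≤n) room
        full : ∀ X → capacity X (deg G u) ≤ a X u
        full X with a X u <? capacity X (deg G u)
        ... | no ¬room = ≮⇒≥ ¬room
        ... | yes room = contradiction
          (room , subst (_< capacity X (deg G v)) (sym (v-bare X)) (positive X room) , λ _ → inj₂ (v-bare X))
          (blocked X)

    removal-reduction : (∀ D → ¬ (∀ X → ¬ Admissible D X)) → Reduction G
    removal-reduction not-blocked = record
      { smaller   = G∖uv
      ; smaller⊆G = removeEdges⊆G G isUV isUV-sym
      ; size-<    = size-removeEdges-< G isUV isUV-sym uv (Endpoint.lost endpoint-u)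
      ; lift      = λ D → extend-unless-blocked D (not-blocked D)
      }

    light-edge-reduction : deg G u + deg G v ≤ α → Reduction G
    light-edge-reduction light = removal-reduction λ D blocked →
      <⇒≱ α<η+6 (≤-trans (heavy-if-blocked D blocked) light)
      where
      α<η+6 : α < η + 6
      α<η+6 = subst (_< η + 6) (m∸n+n≡m 5≤α) (+-monoʳ-< η (n<1+n 5))

    leaf-reduction : deg G v ≡ 1 → Reduction G
    leaf-reduction leaf = removal-reduction λ D blocked → leaf-if-blocked D blocked leaf

  module IsolatedVertex {N : ℕ} (A : Fin (suc N) → Fin (suc N) → Bool) (A-sym : ∀ a b → A a b ≡ A b a)
                        (A-irrefl : ∀ a → A a a ≡ false) (v : Fin (suc N)) (isolated : ∀ b → A v b ≡ false) where

    open VertexDeletion A A-sym A-irrefl v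

    module _ (D : Decomposition G-v) where

      private
        κ′ = colouring D

      colourᵈ : ∀ a b → Dec (v ≡ a) → Dec (v ≡ b) → Fin 3
      colourᵈ a b (yes _)   _         = 2F
      colourᵈ a b (no _)    (yes _)   = 2F
      colourᵈ a b (no v≢a)  (no v≢b)  = colour κ′ (punchOut v≢a) (punchOut v≢b)

      colourᵈ-sym : ∀ a b da db → colourᵈ a b da db ≡ colourᵈ b a db da
      colourᵈ-sym a b (yes _) (yes _) = refl
      colourᵈ-sym a b (yes _) (no _)  = refl
      colourᵈ-sym a b (no _)  (yes _) = refl
      colourᵈ-sym a b (no _)  (no _)  = colour-sym κ′ _ _

      colourᵈ-away : ∀ {a b} (v≢a : v ≢ a) (v≢b : v ≢ b) da db →
                     colourᵈ a b da db ≡ colour κ′ (punchOut v≢a) (punchOut v≢b)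
      colourᵈ-away v≢a _   (yes v≡a) _         = contradiction v≡a v≢a
      colourᵈ-away _   v≢b (no _)    (yes v≡b) = contradiction v≡b v≢b
      colourᵈ-away _   _   (no _)    (no _)    = cong₂ (colour κ′) (punchOut-cong v refl) (punchOut-cong v refl)

      lifted : Colouring G
      lifted = record
        { colour     = λ a b → colourᵈ a b (v ≟ a) (v ≟ b)
        ; colour-sym = λ a b → colourᵈ-sym a b (v ≟ a) (v ≟ b)
        }

      v≢punchIn : ∀ a → v ≢ punchIn v a
      v≢punchIn a = punchInᵢ≢i v a ∘ sym

      colour-punchIn : ∀ a b → colour lifted (punchIn v a) (punchIn v b) ≡ colour κ′ a b
      colour-punchIn a b = trans (colourᵈ-away (v≢punchIn a) (v≢punchIn b) (v ≟ punchIn v a) (v ≟ punchIn v b))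
        (cong₂ (colour κ′) (punchOut-punchIn v) (punchOut-punchIn v))

      deg-lifted : ∀ X a → degᶜ lifted X (punchIn v a) ≡ degᶜ κ′ X a
      deg-lifted X a = begin
        degᶜ lifted X (punchIn v a)                             ≡⟨ deg≡∑ (class lifted X) (punchIn v a) ⟩
        ∑ (λ b → 𝟙 (A (punchIn v a) b ∧ ⌊ colour lifted (punchIn v a) b ≟ X ⌋))
          ≡⟨ ∑-skip v (λ b → 𝟙 (A (punchIn v a) b ∧ ⌊ colour lifted (punchIn v a) b ≟ X ⌋))
               (cong (λ x → 𝟙 (x ∧ ⌊ colour lifted (punchIn v a) v ≟ X ⌋)) (trans (A-sym _ v) (isolated _))) ⟩
        ∑ (λ b → 𝟙 (A (punchIn v a) (punchIn v b) ∧ ⌊ colour lifted (punchIn v a) (punchIn v b) ≟ X ⌋))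
          ≡⟨ sum-cong-≗ (λ b → cong (λ c → 𝟙 (A (punchIn v a) (punchIn v b) ∧ ⌊ c ≟ X ⌋)) (colour-punchIn a b)) ⟩
        ∑ (λ b → 𝟙 (A (punchIn v a) (punchIn v b) ∧ ⌊ colour κ′ a b ≟ X ⌋))
          ≡⟨ deg≡∑ (class κ′ X) a ⟨
        degᶜ κ′ X a                                             ∎
        where open ≡-Reasoning

      deg-lifted-v : ∀ X → degᶜ lifted X v ≡ 0
      deg-lifted-v X = trans (deg≡∑ (class lifted X) v) (∑-zero (λ b → cong (λ x → 𝟙 (x ∧ ⌊ colour lifted v b ≟ X ⌋)) (isolated b)))

      bounded-lifted : ∀ X a → Dec (v ≡ a) → degᶜ lifted X a ≤ capacity X (deg G a)
      bounded-lifted X a (yes refl) = subst (_≤ capacity X (deg G v)) (sym (deg-lifted-v X)) z≤n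
      bounded-lifted X a (no v≢a) = subst (λ b → degᶜ lifted X b ≤ capacity X (deg G b)) (punchIn-punchOut v≢a)
        (subst₂ (λ d e → d ≤ capacity X e) (sym (deg-lifted X _)) (sym (deg-G-v isolated _)) (bounded D X _))

      forest-lifted : ∀ X → Forest (class κ′ X) → Forest (class lifted X)
      forest-lifted X forest C = forest record
        { len      = len C
        ; len≥3    = len≥3 C
        ; vs       = λ i → punchOut (v≢vs i)
        ; periodic = λ i → punchOut-cong v (periodic C i)
        ; distinct = λ i j i<L j<L eq → distinct C i j i<L j<L (punchOut-injective (v≢vs i) (v≢vs j) eq)
        ; adjacent = adjacent′
        }
        where
        v≢vs : ∀ i → v ≢ vs C i
        v≢vs i v≡ with () ← trans (sym (∧-conicalˡ _ _ (adjacent C i))) (subst (λ w → A w (vs C (suc i)) ≡ false) v≡ (isolated _))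
        adjacent′ : ∀ i → adj (class κ′ X) (punchOut (v≢vs i)) (punchOut (v≢vs (suc i))) ≡ true
        adjacent′ i = trans (cong (λ c → A (punchIn v a) (punchIn v b) ∧ ⌊ c ≟ X ⌋) (sym (colour-punchIn a b)))
          (subst₂ (λ p q → A p q ∧ ⌊ colour lifted p q ≟ X ⌋ ≡ true)
            (sym (punchIn-punchOut (v≢vs i))) (sym (punchIn-punchOut (v≢vs (suc i)))) (adjacent C i))
          where
          a = punchOut (v≢vs i)
          b = punchOut (v≢vs (suc i))

    isolated-lift : Decomposition G-v → Decomposition G
    isolated-lift D = record
      { colouring = lifted D
      ; forest    = λ X X≢2F → forest-lifted D X (forest D X X≢2F)
      ; bounded   = λ X a → bounded-lifted D X a (v ≟ a)
      }

  -- A vertex of a 2-alternating cycle between two degree-2 vertices regains two edges: the one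
  -- coloured forward, and the one coloured backward p, where p is the colour of the other edge
  -- at its degree-2 end.
  module OddVertex (d : ℕ) (a : Fin 3 → ℕ) (a≤capacity : ∀ X → a X ≤ capacity X d)
                   (d≡ : d ≡ a 0F + a 1F + a 2F) where

    κ⁺ : ℕ
    κ⁺ = κ (2 + d)

    opaque
      forward : Fin 3
      forward = if ⌊ a 1F <? κ⁺ ⌋ then 1F else 2F

      backward : Fin 3 → Fin 3
      backward p = if ⌊ a 0F <? κ⁺ ⌋ then 0F else if ⌊ (p ≟ 2F) ×-dec (2 + a 1F ≤? κ⁺) ⌋ then 1F else 2F

      forward-spec : a 1F < κ⁺ × forward ≡ 1F ⊎ κ⁺ ≤ a 1F × forward ≡ 2F
      forward-spec with if-dec (a 1F <? κ⁺) {1F} {2F}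
      ... | inj₁ (room , f≡) = inj₁ (room , f≡)
      ... | inj₂ (¬room , f≡) = inj₂ (≮⇒≥ ¬room , f≡)

      backward-spec : ∀ p → a 0F < κ⁺ × backward p ≡ 0F
                          ⊎ κ⁺ ≤ a 0F × (p ≡ 2F × 2 + a 1F ≤ κ⁺) × backward p ≡ 1F
                          ⊎ κ⁺ ≤ a 0F × ¬ (p ≡ 2F × 2 + a 1F ≤ κ⁺) × backward p ≡ 2F
      backward-spec p with if-dec (a 0F <? κ⁺) {0F} {if ⌊ (p ≟ 2F) ×-dec (2 + a 1F ≤? κ⁺) ⌋ then 1F else 2F}
      ... | inj₁ (room , b≡) = inj₁ (room , b≡)
      ... | inj₂ (¬room , b≡) with if-dec ((p ≟ 2F) ×-dec (2 + a 1F ≤? κ⁺)) {1F} {2F}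
      ...   | inj₁ (c , b≡′) = inj₂ (inj₁ (≮⇒≥ ¬room , c , trans b≡ b≡′))
      ...   | inj₂ (¬c , b≡′) = inj₂ (inj₂ (≮⇒≥ ¬room , ¬c , trans b≡ b≡′))

    forward≢0F : forward ≢ 0F
    forward≢0F with forward-spec
    ... | inj₁ (_ , f≡) = λ f≡0F → case (trans (sym f≡) f≡0F) of λ ()
    ... | inj₂ (_ , f≡) = λ f≡0F → case (trans (sym f≡) f≡0F) of λ ()

    old : ∀ X → a X ≤ capacity X (2 + d)
    old X = ≤-trans (a≤capacity X) (capacity-mono X (m≤n+m d 2))

    full⇒tight : ∀ {t} → t ≤ κ d → κ⁺ ≤ t → κ⁺ ≡ 2 × t ≡ 2
    full⇒tight t≤κ κ⁺≤t with κ-step d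
    ... | inj₁ κ⁺≡2 = κ⁺≡2 , ≤-antisym (≤-trans t≤κ (≤-trans (κ-mono (m≤n+m d 2)) (≤-reflexive κ⁺≡2)))
                                       (≤-trans (≤-reflexive (sym κ⁺≡2)) κ⁺≤t)
    ... | inj₂ κ<κ⁺ = contradiction (≤-trans κ⁺≤t t≤κ) (<⇒≱ κ<κ⁺)

    residual-room : κ⁺ ≡ 2 → ∀ k → suc k ≤ a 0F + a 1F → a 2F + k ≤ η
    residual-room κ⁺≡2 k k<a₀+a₁ = s≤s⁻¹ (begin
      suc (a 2F + k)        ≡⟨ +-suc (a 2F) k ⟨
      a 2F + suc k          ≤⟨ +-monoʳ-≤ (a 2F) k<a₀+a₁ ⟩
      a 2F + (a 0F + a 1F)  ≡⟨ +-comm (a 2F) (a 0F + a 1F) ⟩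
      a 0F + a 1F + a 2F    ≡⟨ d≡ ⟨
      d                     ≤⟨ s≤s⁻¹ (s≤s⁻¹ (s≤s⁻¹ (subst (λ k → suc (2 + d) ≤ k + k + η) κ⁺≡2 (1+d≤2κ+η (2 + d))))) ⟩
      suc η                 ∎)
      where open ≤-Reasoning

    private
      +0≤ : ∀ {t c} → t ≤ c → t + 0 ≤ c
      +0≤ {t} {c} = subst (_≤ c) (sym (+-identityʳ t))
      +1≤ : ∀ {t c} → t < c → t + 1 ≤ c
      +1≤ {t} {c} = subst (_≤ c) (+-comm 1 t)
      +2≤ : ∀ {t c} → 2 + t ≤ c → t + 2 ≤ c
      +2≤ {t} {c} = subst (_≤ c) (+-comm 2 t)

      tight₀ : κ⁺ ≤ a 0F → κ⁺ ≡ 2 × a 0F ≡ 2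
      tight₀ = full⇒tight (a≤capacity 0F)
      tight₁ : κ⁺ ≤ a 1F → κ⁺ ≡ 2 × a 1F ≡ 2
      tight₁ = full⇒tight (a≤capacity 1F)

      2≤a₀+a₁ : a 0F ≡ 2 ⊎ a 1F ≡ 2 → 2 ≤ a 0F + a 1F
      2≤a₀+a₁ (inj₁ a₀≡2) = ≤-trans (≤-reflexive (sym a₀≡2)) (m≤m+n (a 0F) (a 1F))
      2≤a₀+a₁ (inj₂ a₁≡2) = ≤-trans (≤-reflexive (sym a₁≡2)) (m≤n+m (a 1F) (a 0F))

    fits : ∀ p X → a X + (𝟙 ⌊ backward p ≟ X ⌋ + 𝟙 ⌊ forward ≟ X ⌋) ≤ capacity X (2 + d)
    fits p 0F rewrite 𝟙≟-no forward≢0F with backward-spec p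
    ... | inj₁ (room , b≡)             rewrite b≡ = +1≤ room
    ... | inj₂ (inj₁ (_ , _ , b≡))     rewrite b≡ = +0≤ (old 0F)
    ... | inj₂ (inj₂ (_ , _ , b≡))     rewrite b≡ = +0≤ (old 0F)
    fits p 1F with backward-spec p | forward-spec
    ... | inj₁ (_ , b≡)                       | inj₁ (room , f≡) rewrite b≡ | f≡ = +1≤ room
    ... | inj₁ (_ , b≡)                       | inj₂ (_ , f≡)    rewrite b≡ | f≡ = +0≤ (old 1F)
    ... | inj₂ (inj₁ (_ , (_ , room₂) , b≡))  | inj₁ (_ , f≡)    rewrite b≡ | f≡ = +2≤ room₂
    ... | inj₂ (inj₁ (_ , (_ , room₂) , b≡))  | inj₂ (_ , f≡)    rewrite b≡ | f≡ = +1≤ (≤-trans (n≤1+n _) room₂)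
    ... | inj₂ (inj₂ (_ , _ , b≡))            | inj₁ (room , f≡) rewrite b≡ | f≡ = +1≤ room
    ... | inj₂ (inj₂ (_ , _ , b≡))            | inj₂ (_ , f≡)    rewrite b≡ | f≡ = +0≤ (old 1F)
    fits p 2F with backward-spec p | forward-spec
    ... | inj₁ (_ , b≡)                   | inj₁ (_ , f≡)     rewrite b≡ | f≡ = +0≤ (old 2F)
    ... | inj₂ (inj₁ (_ , _ , b≡))        | inj₁ (_ , f≡)     rewrite b≡ | f≡ = +0≤ (old 2F)
    ... | inj₁ (_ , b≡)                   | inj₂ (full₁ , f≡) rewrite b≡ | f≡ =
      let κ⁺≡2 , a₁≡2 = tight₁ full₁ in residual-room κ⁺≡2 1 (2≤a₀+a₁ (inj₂ a₁≡2))
    ... | inj₂ (inj₁ (_ , _ , b≡))        | inj₂ (full₁ , f≡) rewrite b≡ | f≡ =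
      let κ⁺≡2 , a₁≡2 = tight₁ full₁ in residual-room κ⁺≡2 1 (2≤a₀+a₁ (inj₂ a₁≡2))
    ... | inj₂ (inj₂ (full₀ , _ , b≡))    | inj₁ (_ , f≡)     rewrite b≡ | f≡ =
      let κ⁺≡2 , a₀≡2 = tight₀ full₀ in residual-room κ⁺≡2 1 (2≤a₀+a₁ (inj₁ a₀≡2))
    ... | inj₂ (inj₂ (full₀ , _ , b≡))    | inj₂ (full₁ , f≡) rewrite b≡ | f≡ =
      let κ⁺≡2 , a₀≡2 = tight₀ full₀ ; _ , a₁≡2 = tight₁ full₁
      in residual-room κ⁺≡2 2 (≤-trans (n≤1+n 3) (≤-reflexive (sym (cong₂ _+_ a₀≡2 a₁≡2))))

    forward≡2F⇒1≤η : forward ≡ 2F → 1 ≤ η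
    forward≡2F⇒1≤η f≡2F with forward-spec
    ... | inj₁ (_ , f≡1F) = case trans (sym f≡1F) f≡2F of λ ()
    ... | inj₂ (full₁ , _) = let κ⁺≡2 , a₁≡2 = tight₁ full₁ in
      ≤-trans (m≤n+m 1 (a 2F)) (residual-room κ⁺≡2 1 (2≤a₀+a₁ (inj₂ a₁≡2)))

    pendant-pair : ∀ p X → X ≢ 2F → p ≢ 0F → 𝟙 ⌊ backward p ≟ X ⌋ + 𝟙 ⌊ p ≟ X ⌋ ≤ 1
    pendant-pair p 0F _ p≢0F rewrite 𝟙≟-no p≢0F | +-identityʳ (𝟙 ⌊ backward p ≟ 0F ⌋) = 𝟙≤1 _
    pendant-pair p 1F _ _ with backward-spec p
    ... | inj₁ (_ , b≡)                      rewrite b≡ = 𝟙≤1 _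
    ... | inj₂ (inj₁ (_ , (refl , _) , b≡))  rewrite b≡ = ≤-refl
    ... | inj₂ (inj₂ (_ , _ , b≡))           rewrite b≡ = 𝟙≤1 _
    pendant-pair p 2F 2F≢2F _ = contradiction refl 2F≢2F

    residual-pair : ∀ p → (p ≡ 2F → 1 ≤ η) → 𝟙 ⌊ backward p ≟ 2F ⌋ + 𝟙 ⌊ p ≟ 2F ⌋ ≤ η
    residual-pair p p≡2F⇒1≤η with backward-spec p
    ... | inj₁ (_ , b≡)            rewrite b≡ = 𝟙≟-elim (_≤ η) p≡2F⇒1≤η (λ _ → z≤n)
    ... | inj₂ (inj₁ (_ , _ , b≡)) rewrite b≡ = 𝟙≟-elim (_≤ η) p≡2F⇒1≤η (λ _ → z≤n)
    ... | inj₂ (inj₂ (full₀ , ¬c , b≡)) rewrite b≡ = 𝟙≟-elim (λ k → 1 + k ≤ η) both-residual one-residual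
      where
      κ⁺≡2 = proj₁ (tight₀ full₀)
      a₀≡2 = proj₂ (tight₀ full₀)
      one-residual : p ≢ 2F → 1 ≤ η
      one-residual _ = ≤-trans (m≤n+m 1 (a 2F)) (residual-room κ⁺≡2 1 (2≤a₀+a₁ (inj₁ a₀≡2)))
      both-residual : p ≡ 2F → 2 ≤ η
      both-residual p≡2F = ≤-trans (m≤n+m 2 (a 2F))
        (residual-room κ⁺≡2 2 (subst (3 ≤_) (cong (_+ a 1F) (sym a₀≡2)) (+-monoʳ-≤ 2 1≤a₁)))
        where
        1≤a₁ : 1 ≤ a 1F
        1≤a₁ = ≰⇒> (λ a₁≤0 → ¬c (p≡2F , ≤-trans (+-monoʳ-≤ 2 a₁≤0) (≤-reflexive (sym κ⁺≡2))))

  isolated-vertex-reduction : (G : Graph) (v : Fin (n G)) → deg G v ≡ 0 → Reduction G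
  isolated-vertex-reduction record { n = suc N ; adj = A ; sym = A-sym ; irrefl = A-irrefl } v d≡0 = record
    { smaller   = G-v
    ; smaller⊆G = G-v⊆G
    ; size-<    = size-G-v-< isolated
    ; lift      = isolated-lift
    }
    where
    isolated = deg≡0⇒¬adj (VertexDeletion.G A A-sym A-irrefl v) d≡0
    open VertexDeletion A A-sym A-irrefl v
    open IsolatedVertex A A-sym A-irrefl v isolated

  trivial-decomposition : (G : Graph) → n G ≡ 0 → Decomposition G
  trivial-decomposition G n≡0 = record
    { colouring = record { colour = λ a → no-vertex a ; colour-sym = λ a → no-vertex a }
    ; forest    = λ _ _ C → no-vertex (vs C 0)
    ; bounded   = λ _ a → no-vertex a
    }
    where
    no-vertex : ∀ {A : Set} → Fin (n G) → A
    no-vertex a with () ← subst Fin n≡0 a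

  module AlternatingCycleLift {G : Graph} (C : Cycle G) (m : ℕ) (2≤m : 2 ≤ m) (len≡ : len C ≡ 2 * m)
                              (deg-even : ∀ i → i < m → deg G (vs C (2 * i)) ≡ 2)
                              (D : Decomposition (AlternatingCycle.G′ C m 2≤m len≡ deg-even)) where

    open AlternatingCycle C m 2≤m len≡ deg-even

    private
      V = Fin (n G)
      κ′ = colouring D

    module Odd (j : ℕ) = OddVertex (deg G′ (od j)) (λ X → degᶜ κ′ X (od j)) (λ X → bounded D X (od j))
                                   (deg-partition κ′ (od j))
    open Odd using (forward; backward)

    edgeColour : ℕ → V → Fin 3
    edgeColour i b = if ⌊ b ≟ od i ⌋ then backward i (forward (prev i)) else forward (prev i)

    σᵈ : ∀ a b → Dec (IsEven a) → Dec (IsEven b) → Fin 3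
    σᵈ a b (yes (i , _)) (no _)        = edgeColour i b
    σᵈ a b (no _)        (yes (j , _)) = edgeColour j a
    σᵈ a b (yes _)       (yes _)       = 2F
    σᵈ a b (no _)        (no _)        = 2F

    σᵈ-sym : ∀ a b da db → σᵈ a b da db ≡ σᵈ b a db da
    σᵈ-sym a b (yes _) (yes _) = refl
    σᵈ-sym a b (yes _) (no _)  = refl
    σᵈ-sym a b (no _)  (yes _) = refl
    σᵈ-sym a b (no _)  (no _)  = refl

    σ : V → V → Fin 3
    σ a b = σᵈ a b (isEven? a) (isEven? b)

    σ-sym : ∀ a b → σ a b ≡ σ b a
    σ-sym a b = σᵈ-sym a b (isEven? a) (isEven? b)

    σᵈ-ev : ∀ {i b} → i < m → ¬ IsEven b → ∀ da db → σᵈ (ev i) b da db ≡ edgeColour i b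
    σᵈ-ev {i} {b} i<m _ (yes (i′ , i′<m , eq)) (no _) = cong (λ k → edgeColour k b) {i′} {i} (ev-injective i′<m i<m eq)
    σᵈ-ev i<m ¬even (yes _) (yes even) = contradiction even ¬even
    σᵈ-ev {i} i<m _ (no ¬even) _       = contradiction (i , i<m , refl) ¬even

    σ-ev-od : ∀ {i} → i < m → σ (ev i) (od i) ≡ backward i (forward (prev i))
    σ-ev-od {i} i<m = trans (σᵈ-ev {i} {od i} i<m (od-¬IsEven i<m) (isEven? (ev i)) (isEven? (od i)))
      (cong (λ x → if x then backward i (forward (prev i)) else forward (prev i)) (⌊⌋-yes (od i ≟ od i) refl))

    σ-ev-od-prev : ∀ {i} → i < m → σ (ev i) (od (prev i)) ≡ forward (prev i)
    σ-ev-od-prev {i} i<m = trans (σᵈ-ev {i} {od (prev i)} i<m (od-¬IsEven (prev< i<m)) (isEven? (ev i)) (isEven? (od (prev i))))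
      (cong (λ x → if x then backward i (forward (prev i)) else forward (prev i))
            (⌊⌋-no (od (prev i) ≟ od i) (od≢od-prev i<m ∘ sym)))

    open Recolouring touchesEven touchesEven-sym κ′ σ σ-sym

    added : Fin 3 → V → V → ℕ
    added X a b = 𝟙 ((adj G a b ∧ touchesEven a b) ∧ ⌊ σ a b ≟ X ⌋)

    added-on : ∀ {X a b c} → adj G a b ≡ true → touchesEven a b ≡ true → σ a b ≡ c → added X a b ≡ 𝟙 ⌊ c ≟ X ⌋
    added-on {X} ab touches σ≡ = cong₂ (λ x y → 𝟙 (x ∧ ⌊ y ≟ X ⌋)) (cong₂ _∧_ ab touches) σ≡

    added-off : ∀ {X a b} → adj G a b ∧ touchesEven a b ≡ false → added X a b ≡ 0
    added-off {X} {a} {b} lost rewrite lost = refl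

    touches-ev : ∀ {i} → i < m → ∀ b → touchesEven (ev i) b ≡ true
    touches-ev {i} i<m b = cong (_∨ isEven b) (ev-isEven {i} i<m)

    deg-at-even : ∀ {i} → i < m → ∀ X →
      degᶜ recoloured X (ev i) ≡ 𝟙 ⌊ backward i (forward (prev i)) ≟ X ⌋ + 𝟙 ⌊ forward (prev i) ≟ X ⌋
    deg-at-even {i} i<m X = begin
      degᶜ recoloured X (ev i)                              ≡⟨ deg-recoloured X (ev i) ⟩
      degᶜ κ′ X (ev i) + ∑ (added X (ev i))                 ≡⟨ cong (_+ ∑ (added X (ev i))) kept≡0 ⟩
      ∑ (added X (ev i))                                    ≡⟨ ∑-support₂ (added X (ev i)) (od≢od-prev i<m) off ⟩
      added X (ev i) (od i) + added X (ev i) (od (prev i))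
        ≡⟨ cong₂ _+_ (added-on {X} {ev i} {od i} (ev-od-adj i) (touches-ev {i} i<m (od i)) (σ-ev-od {i} i<m))
                     (added-on {X} {ev i} {od (prev i)} (trans (adj-sym G (ev i) (od (prev i))) (od-prev-ev-adj {i} i<m))
                               (touches-ev {i} i<m (od (prev i))) (σ-ev-od-prev {i} i<m)) ⟩
      𝟙 ⌊ backward i (forward (prev i)) ≟ X ⌋ + 𝟙 ⌊ forward (prev i) ≟ X ⌋ ∎
      where
      open ≡-Reasoning
      kept≡0 : degᶜ κ′ X (ev i) ≡ 0
      kept≡0 = trans (deg≡∑ (class κ′ X) (ev i)) (∑-zero λ b →
        cong (λ x → 𝟙 ((adj G (ev i) b ∧ not x) ∧ ⌊ colour κ′ (ev i) b ≟ X ⌋)) (touches-ev {i} i<m b)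
        ⟨ trans ⟩ cong (λ x → 𝟙 (x ∧ ⌊ colour κ′ (ev i) b ≟ X ⌋)) (∧-zeroʳ (adj G (ev i) b)))
      off : ∀ b → b ≢ od i → b ≢ od (prev i) → added X (ev i) b ≡ 0
      off b b≢ b≢′ = added-off {X} {ev i} {b} (¬-not λ lost →
        [ b≢ , b≢′ ]′ (even-neighbours i<m b (∧-conicalˡ (adj G (ev i) b) (touchesEven (ev i) b) lost)))

    private
      next-facts : ∀ {j} → j < m → adj G (od j) (ev (next j)) ≡ true × σ (od j) (ev (next j)) ≡ forward j
      next-facts {j} j<m = subst (λ k → adj G (od k) (ev (next j)) ≡ true × σ (od k) (ev (next j)) ≡ forward k)
        (prev-next j<m) (od-prev-ev-adj {next j} (next< j<m) ,
                         trans (σ-sym (od (prev (next j))) (ev (next j))) (σ-ev-od-prev {next j} (next< j<m)))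

      ev≢ev-next : ∀ {j} → j < m → ev j ≢ ev (next j)
      ev≢ev-next j<m eq = next≢ j<m (sym (ev-injective j<m (next< j<m) eq))

      touches-odd-ev : ∀ {j} → j < m → ∀ i → i < m → touchesEven (od j) (ev i) ≡ true
      touches-odd-ev {j} j<m i i<m = trans (touchesEven-sym (od j) (ev i)) (touches-ev {i} i<m (od j))

    deg-at-odd : ∀ {j} → j < m → ∀ X → degᶜ recoloured X (od j)
                 ≡ degᶜ κ′ X (od j) + (𝟙 ⌊ backward j (forward (prev j)) ≟ X ⌋ + 𝟙 ⌊ forward j ≟ X ⌋)
    deg-at-odd {j} j<m X = trans (deg-recoloured X (od j)) (cong (degᶜ κ′ X (od j) +_) (begin
      ∑ (added X (od j))                                   ≡⟨ ∑-support-by (added X (od j)) (λ b → adj G (od j) b ∧ touchesEven (od j) b)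
                                                                (ev≢ev-next j<m) (lost-at-odd j<m) (λ b → added-off {X} {od j} {b}) ⟩
      added X (od j) (ev j) + added X (od j) (ev (next j)) ≡⟨ cong₂ _+_ at-ev at-next ⟩
      𝟙 ⌊ backward j (forward (prev j)) ≟ X ⌋ + 𝟙 ⌊ forward j ≟ X ⌋ ∎))
      where
      open ≡-Reasoning
      at-ev : added X (od j) (ev j) ≡ 𝟙 ⌊ backward j (forward (prev j)) ≟ X ⌋
      at-ev = added-on {X} {od j} {ev j} (trans (adj-sym G (od j) (ev j)) (ev-od-adj j)) (touches-odd-ev {j} j<m j j<m)
                (trans (σ-sym (od j) (ev j)) (σ-ev-od {j} j<m))
      at-next : added X (od j) (ev (next j)) ≡ 𝟙 ⌊ forward j ≟ X ⌋
      at-next = added-on {X} {od j} {ev (next j)} (proj₁ (next-facts {j} j<m)) (touches-odd-ev {j} j<m (next j) (next< j<m))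
                  (proj₂ (next-facts {j} j<m))

    deg-G-at-odd : ∀ {j} → j < m → deg G (od j) ≡ 2 + deg G′ (od j)
    deg-G-at-odd {j} j<m = begin
      deg G (od j)                          ≡⟨ deg-removeEdges G touchesEven touchesEven-sym (od j) ⟩
      deg G′ (od j) + ∑ (λ b → 𝟙 (lost b)) ≡⟨ cong (deg G′ (od j) +_) (∑-support-by (λ b → 𝟙 (lost b)) lost (ev≢ev-next j<m)
                                                  (lost-at-odd j<m) (λ b → cong 𝟙)) ⟩
      deg G′ (od j) + (𝟙 (lost (ev j)) + 𝟙 (lost (ev (next j))))
        ≡⟨ cong (deg G′ (od j) +_) (cong₂ (λ x y → 𝟙 x + 𝟙 y)
             (cong₂ _∧_ (trans (adj-sym G (od j) (ev j)) (ev-od-adj j)) (touches-odd-ev {j} j<m j j<m))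
             (cong₂ _∧_ (proj₁ (next-facts {j} j<m)) (touches-odd-ev {j} j<m (next j) (next< j<m)))) ⟩
      deg G′ (od j) + 2                     ≡⟨ +-comm (deg G′ (od j)) 2 ⟩
      2 + deg G′ (od j)                     ∎
      where
      open ≡-Reasoning
      lost : V → Bool
      lost b = adj G (od j) b ∧ touchesEven (od j) b

    deg-elsewhere : ∀ {a} → ¬ IsEven a → (∀ j → j < m → od j ≢ a) → ∀ X → degᶜ recoloured X a ≡ degᶜ κ′ X a
    deg-elsewhere {a} ¬even ¬odd X = trans (deg-recoloured X a)
      (trans (cong (degᶜ κ′ X a +_) (∑-zero (λ b → added-off {X} {a} {b} (lost-elsewhere ¬even ¬odd b))))
             (+-identityʳ (degᶜ κ′ X a)))

    pendant-at-even : ∀ {i} → i < m → ∀ X → X ≢ 2F → degᶜ recoloured X (ev i) ≤ 1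
    pendant-at-even {i} i<m X X≢2F = subst (_≤ 1) (sym (deg-at-even {i} i<m X))
      (Odd.pendant-pair i (forward (prev i)) X X≢2F (Odd.forward≢0F (prev i)))

    bounded-at-even : ∀ {i} → i < m → ∀ X → degᶜ recoloured X (ev i) ≤ capacity X (deg G (ev i))
    bounded-at-even {i} i<m 0F = ≤-trans (pendant-at-even {i} i<m 0F (λ ())) (≤-trans (n≤1+n 1) (2≤κ (deg G (ev i))))
    bounded-at-even {i} i<m 1F = ≤-trans (pendant-at-even {i} i<m 1F (λ ())) (≤-trans (n≤1+n 1) (2≤κ (deg G (ev i))))
    bounded-at-even {i} i<m 2F = subst (_≤ η) (sym (deg-at-even {i} i<m 2F))
      (Odd.residual-pair i (forward (prev i)) (Odd.forward≡2F⇒1≤η (prev i)))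

    bounded-at-odd : ∀ {j} → j < m → ∀ X → degᶜ recoloured X (od j) ≤ capacity X (deg G (od j))
    bounded-at-odd {j} j<m X = subst₂ (λ c e → c ≤ capacity X e) (sym (deg-at-odd {j} j<m X)) (sym (deg-G-at-odd {j} j<m))
      (Odd.fits j (forward (prev j)) X)

    bounded-recoloured : ∀ X a → degᶜ recoloured X a ≤ capacity X (deg G a)
    bounded-recoloured X a with vertex-kind a
    ... | inj₁ (i , i<m , refl)         = bounded-at-even {i} i<m X
    ... | inj₂ (inj₁ (j , j<m , refl)) = bounded-at-odd {j} j<m X
    ... | inj₂ (inj₂ (¬even , ¬odd))   = subst (_≤ _) (sym (deg-elsewhere ¬even ¬odd X)) (bounded-removeEdges D X a)

    pendant-edge : ∀ X → X ≢ 2F → ∀ a b → adj (class recoloured X) a b ≡ true → touchesEven a b ≡ true →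
                   degᶜ recoloured X a ≤ 1 ⊎ degᶜ recoloured X b ≤ 1
    pendant-edge X X≢2F a b _ touches with ∨-true touches
    ... | inj₁ even-a with ⌊⌋⇒ (isEven? a) even-a
    ...   | i , i<m , refl = inj₁ (pendant-at-even {i} i<m X X≢2F)
    pendant-edge X X≢2F a b _ touches | inj₂ even-b with ⌊⌋⇒ (isEven? b) even-b
    ...   | i , i<m , refl = inj₂ (pendant-at-even {i} i<m X X≢2F)

    lift : Decomposition G
    lift = record
      { colouring = recoloured
      ; forest    = λ X X≢2F → recoloured-forest X (forest D X X≢2F) (pendant-edge X X≢2F)
      ; bounded   = bounded-recoloured
      }

  two-alternating-cycle-reduction : (G : Graph) → TwoAlternatingCycle G → Reduction G
  two-alternating-cycle-reduction G (C , m , 2≤m , len≡ , deg-even) = record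
    { smaller   = G′
    ; smaller⊆G = removeEdges⊆G G touchesEven touchesEven-sym
    ; size-<    = size-G′-<
    ; lift      = AlternatingCycleLift.lift C m 2≤m len≡ deg-even
    }
    where open AlternatingCycle C m 2≤m len≡ deg-even

  reduction : ∀ G →
    (∃[ v ] deg G v ≤ 1)
    ⊎ (∃[ u ] ∃[ v ] (adj G u v ≡ true × deg G u + deg G v ≤ α))
    ⊎ TwoAlternatingCycle G →
    Reduction G
  reduction G (inj₁ (v , d≤1)) with deg G v in d≡
  ... | 0 = isolated-vertex-reduction G v d≡
  ... | 1 = EdgeRemoval.leaf-reduction (trans (adj-sym G _ v) (proj₂ (deg≡1⇒∃adj G d≡))) d≡
  ... | suc (suc _) = contradiction d≤1 λ { (s≤s ()) }
  reduction G (inj₂ (inj₁ (u , v , uv , light))) = EdgeRemoval.light-edge-reduction uv light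
  reduction G (inj₂ (inj₂ T)) = two-alternating-cycle-reduction G T

  module _ (𝒢 : Graph → Set) (hereditary : Hereditary 𝒢)
           (reducible : ∀ G → 𝒢 G → 0 < n G →
              (∃[ v ] deg G v ≤ 1)
              ⊎ (∃[ u ] ∃[ v ] (adj G u v ≡ true × deg G u + deg G v ≤ α))
              ⊎ TwoAlternatingCycle G) where

    decompose : ∀ G → 𝒢 G → Decomposition G
    decompose = All.wfRec (On.wellFounded size <-wellFounded) 0ℓ (λ G → 𝒢 G → Decomposition G) step
      where
      step : ∀ G → (∀ {H} → size H < size G → 𝒢 H → Decomposition H) → 𝒢 G → Decomposition G
      step G decompose-smaller G∈𝒢 with n G ℕ.≟ 0
      ... | yes n≡0 = trivial-decomposition G n≡0
      ... | no n≢0  = lift (decompose-smaller size-< (hereditary G smaller smaller⊆G G∈𝒢))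
        where open Reduction (reduction G (reducible G G∈𝒢 (n≢0⇒n>0 n≢0)))

theorem4 : (α : ℕ) → 5 ≤ α → (𝒢 : Graph → Set) → Hereditary 𝒢 →
    (∀ G → 𝒢 G → 0 < n G →
      (∃[ v ] deg G v ≤ 1)
      ⊎ (∃[ u ] ∃[ v ] (adj G u v ≡ true × deg G u + deg G v ≤ α))
      ⊎ TwoAlternatingCycle G) →
    ∀ G → 𝒢 G →
    Σ (Fin (n G) → Fin (n G) → Fin 3) λ c →
    Σ (∀ u v → c u v ≡ c v u) λ csym →
      Forest (colourClass G c csym zero)
      × Forest (colourClass G c csym (suc zero))
      × (∀ v → deg (colourClass G c csym zero) v
                 ≤ 2 ⊔ ⌈ (deg G v + 6) ∸ α /2⌉)
      × (∀ v → deg (colourClass G c csym (suc zero)) v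
                 ≤ 2 ⊔ ⌈ (deg G v + 6) ∸ α /2⌉)
      × (∀ v → deg (colourClass G c csym (suc (suc zero))) v ≤ α ∸ 5)
theorem4 α 5≤α 𝒢 hereditary reducible G G∈𝒢 =
  colour (colouring D) , colour-sym (colouring D) ,
  forest D 0F (λ ()) , forest D 1F (λ ()) , bounded D 0F , bounded D 1F , bounded D 2F
  where
  D = decompose α 5≤α 𝒢 hereditary reducible G G∈𝒢
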